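{- For every integer $n\ge 2$ (for the $g$-values) and every integer $n\ge 1$ (for the $h$-values), the following hold: \begin{itemize} \item $g^{(2)}_{\{0\}}(n)=1$, $g^{(2)}_{\{1\}}(n)=2^{\lfloor n/2\rfloor}$, $g^{(2)}_{\{2\}}(n)=1$, $g^{(2)}_{\{0,1\}}(n)=1+2^{n-1}$, $g^{(2)}_{\{1,2\}}(n)=1+2^{n-1}$, $g^{(2)}_{\{0,2\}}(n)=2^{\lfloor n/2\rfloor}$, $g^{(2)}_{\{0,1,2\}}(n)=2^{n}$; \item $h^{(2)}_{\{0\}}(n)=1$, $h^{(2)}_{\{1\}}(n)=2^{\lfloor n/2\rfloor}$, $h^{(2)}_{\{2\}}(n)=1$, $h^{(2)}_{\{1,2\}}(n)=1$, $h^{(2)}_{\{0,2\}}(n)=1$, $h^{(2)}_{\{0,1,2\}}(n)=1$, and \[ h^{(2)}_{\{0,1\}}(n)=\begin{cases} 3^{n/3} & \text{if } n\equiv 0 \pmod 3,\\ 4\cdot 3^{\lfloor n/3\rfloor-1} & \text{if } n\equiv 1 \pmod 3,\\ 2\cdot 3^{\lfloor n/3\rfloor} & \text{if } n\equiv 2 \pmod 3.\end{cases} \] \end{itemize}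
   Context: An $r$-uniform hypergraph is a finite vertex set with a family of $r$-element subsets (hyperedges); a $2$-uniform hypergraph is a simple graph. A vertex is isolated if it lies in no hyperedge. Given a non-empty set $A$ of non-negative integers, a set $S$ of vertices of an $r$-uniform hypergraph $\mathcal{H}$ is an $A$-transversal if $|H\cap S|\in A$ for every hyperedge $H$ of $\mathcal{H}$; an $A$-transversal is maximal if it is not a proper subset of another $A$-transversal. For $n\ge r$, $g^{(r)}_A(n)$ denotes the maximum number of $A$-transversals in an $r$-uniform hypergraph on $n$ vertices with no isolated vertices. $h^{(r)}_A(n)$ denotes the maximum number of maximal $A$-transversals in an $r$-uniform hypergraph on $n$ vertices (isolated vertices allowed). -}

module Defs where

open import Data.Nat using (ℕ; zero; suc; _+_; _≤_; _≟_)
open import Data.Bool using (Bool; true; false)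
open import Data.Fin using (Fin)
open import Data.Fin.Subset using (Subset; inside; outside; _∩_; ∣_∣; _∈_; _⊂_)
open import Data.Fin.Subset.Properties using (anySubset?; _⊂?_; _∈?_)
open import Data.Vec using ([]; _∷_)
open import Data.List using (List)
import Data.List.Membership.DecPropositional as DecMem
open import Data.Product using (Σ; ∃; _×_; _,_)
open import Relation.Nullary using (¬_; Dec; yes; no)
open import Relation.Nullary.Decidable using (_×-dec_; ¬?; does)
open import Relation.Binary.PropositionalEquality using (_≡_; refl)
open import Data.Bool.Properties using () renaming (_≟_ to _≟ᵇ_)
open import Function using (_∘_)

open DecMem _≟_ using () renaming (_∈_ to _∈ᴸ_; _∈?_ to _∈ᴸ?_)

NatSet : Set
NatSet = List ℕ

record Hypergraph (r n : ℕ) : Set where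
  field
    isEdge  : Subset n → Bool
    uniform : ∀ H → isEdge H ≡ true → ∣ H ∣ ≡ r
open Hypergraph public

Isolated : ∀ {r n} → Hypergraph r n → Fin n → Set
Isolated 𝓗 v = ¬ (∃ λ H → isEdge 𝓗 H ≡ true × v ∈ H)

NoIsolated : ∀ {r n} → Hypergraph r n → Set
NoIsolated 𝓗 = ∀ v → ¬ Isolated 𝓗 v

IsTransversal : ∀ {r n} → NatSet → Hypergraph r n → Subset n → Set
IsTransversal A 𝓗 S = ∀ H → isEdge 𝓗 H ≡ true → ∣ H ∩ S ∣ ∈ᴸ A

IsMaximalTransversal : ∀ {r n} → NatSet → Hypergraph r n → Subset n → Set
IsMaximalTransversal A 𝓗 S =
  IsTransversal A 𝓗 S × ¬ (∃ λ T → S ⊂ T × IsTransversal A 𝓗 T)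

private
  bad? : ∀ {r n} (A : NatSet) (𝓗 : Hypergraph r n) (S : Subset n) →
         Dec (∃ λ H → isEdge 𝓗 H ≡ true × ¬ (∣ H ∩ S ∣ ∈ᴸ A))
  bad? A 𝓗 S = anySubset? (λ H → (isEdge 𝓗 H ≟ᵇ true) ×-dec ¬? (∣ H ∩ S ∣ ∈ᴸ? A))

isTransversal? : ∀ {r n} (A : NatSet) (𝓗 : Hypergraph r n) (S : Subset n) →
                 Dec (IsTransversal A 𝓗 S)
isTransversal? A 𝓗 S with bad? A 𝓗 S
... | yes (H , e , ¬m) = no (λ t → ¬m (t H e))
... | no ¬b = yes λ H e → helper H e
  where
  helper : ∀ H → isEdge 𝓗 H ≡ true → ∣ H ∩ S ∣ ∈ᴸ A
  helper H e with ∣ H ∩ S ∣ ∈ᴸ? A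
  ... | yes m = m
  ... | no ¬m = Data.Empty.⊥-elim (¬b (H , e , ¬m))
    where import Data.Empty

isMaximalTransversal? : ∀ {r n} (A : NatSet) (𝓗 : Hypergraph r n) (S : Subset n) →
                        Dec (IsMaximalTransversal A 𝓗 S)
isMaximalTransversal? A 𝓗 S =
  isTransversal? A 𝓗 S ×-dec ¬? (anySubset? (λ T → (S ⊂? T) ×-dec isTransversal? A 𝓗 T))

countSubsets : ∀ {n} {P : Subset n → Set} → (∀ S → Dec (P S)) → ℕ
countSubsets {zero}  P? with P? []
... | yes _ = 1
... | no  _ = 0
countSubsets {suc n} P? = countSubsets (P? ∘ (inside ∷_)) + countSubsets (P? ∘ (outside ∷_))

numTransversals : ∀ {r n} → NatSet → Hypergraph r n → ℕ
numTransversals A 𝓗 = countSubsets (isTransversal? A 𝓗)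

numMaximalTransversals : ∀ {r n} → NatSet → Hypergraph r n → ℕ
numMaximalTransversals A 𝓗 = countSubsets (isMaximalTransversal? A 𝓗)

IsMaximum : ∀ {r n} → (Hypergraph r n → Set) → (Hypergraph r n → ℕ) → ℕ → Set
IsMaximum {r} {n} P f m =
  (∃ λ (𝓗 : Hypergraph r n) → P 𝓗 × f 𝓗 ≡ m) × (∀ (𝓗 : Hypergraph r n) → P 𝓗 → f 𝓗 ≤ m)

g-is : (r : ℕ) → NatSet → (n : ℕ) → ℕ → Set
g-is r A n m = IsMaximum {r} {n} NoIsolated (numTransversals A) m

h-is : (r : ℕ) → NatSet → (n : ℕ) → ℕ → Set
h-is r A n m = IsMaximum {r} {n} (λ _ → Data.Unit.⊤) (numMaximalTransversals A) m
  where import Data.Unit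

{-# OPTIONS --safe #-}
-- In a graph, a set S is a {0,1}-transversal iff it is independent, and a maximal one iff it is a
-- maximal independent set; {1,2}-transversals are the complements of {0,1}-transversals.  Maximal
-- independent sets number at most the Moon–Moser bound: some vertex of a minimum-degree closed
-- neighbourhood N[v] lies in S, and deleting its closed neighbourhood leaves a smaller instance.
-- Without isolated vertices there are at most 2^(n-1) + 1 independent sets, by branching on an edge
-- whose ends both have degree ≥ 2, or else on the centre of a star component.  For A = {1} and
-- A = {0,2}, membership in S propagates along edges, so S is determined by its trace on a dominating
-- set of size ≤ n/2: the smaller of I and its complement among the non-isolated vertices, for I a
-- maximal independent set.  For A = {0} or {2} (without isolated vertices) there is one transversal,
-- and for the remaining A the transversals are closed under union, so there is one maximal
-- transversal.  All bounds are attained by stars or by disjoint unions of K₁, K₂, K₃, K₄ and paths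
-- on three vertices, whose counts multiply.

module Submission where

open import Defs
open import Data.Bool using (Bool; true; false; T; _∧_; _∨_) renaming (_≟_ to _≟ᵇ_)
open import Data.Bool.Properties using (∨-zeroʳ)
open import Data.Empty using (⊥-elim) renaming (⊥ to Empty)
open import Data.Fin using (Fin; zero; suc; _↑ˡ_; _↑ʳ_; splitAt) renaming (_≟_ to _≟ᶠ_)
open import Data.Fin.Properties
  using (all?; any?; splitAt⁻¹-↑ˡ; splitAt⁻¹-↑ʳ; ↑ˡ-injective; ↑ʳ-injective)
open import Data.Fin.Subset
  using (Subset; inside; outside; Nonempty; _∩_; _∪_; _─_; ∁; ∣_∣; _∈_; _∉_; _⊆_; _⊂_; ⁅_⁆; _-_)
  renaming (⊥ to ∅; ⊤ to full)
open import Data.Fin.Subset.Properties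
open import Data.Nat
  using (ℕ; zero; suc; _≟_; _+_; _*_; _∸_; _^_; _≤_; _<_; _≤ᵇ_; _≤?_; z≤n; s≤s)
open import Data.Nat.Properties
open import Data.Nat.DivMod
  using (_/_; _%_; m*n/n≡m; /-monoˡ-≤; m/n≡1+[m∸n]/n; m≡m%n+[m/n]*n)
open import Algebra.Properties.CommutativeSemigroup +-commutativeSemigroup using (interchange)
open import Data.List using ([]; _∷_)
open import Data.List.Relation.Unary.Any using (here; there)
import Data.List.Membership.DecPropositional as DecMembership
open import Data.Product using (∃; _×_; _,_; proj₁; proj₂)
open import Data.Sum using (_⊎_; inj₁; inj₂; map₂)
open import Data.Vec using ([]; _∷_; _++_; here; there; tabulate; take; drop)
open import Data.Vec.Properties
  using (≡-dec; zipWith-++; take++drop≡id; ∷-injectiveʳ; lookup∘tabulate; lookup⇒[]=; []=⇒lookup)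
open import Function using (_∘_; id; case_of_)
open import Data.Nat.Tactic.RingSolver using (solve-∀)
open import Relation.Nullary using (¬_; Dec; yes; no; does)
open import Relation.Nullary.Decidable
  using (_×-dec_; _⊎-dec_; _→-dec_; ¬?; dec-true; decidable-stable; from-no)
open import Relation.Binary.PropositionalEquality
  using (_≡_; _≢_; refl; sym; trans; cong; cong₂; subst)
open import Relation.Unary using (Decidable)

open DecMembership _≟_ using () renaming (_∈_ to _∈ᴸ_; _∈?_ to _∈ᴸ?_)

_≟ˢ_ : ∀ {n} (p q : Subset n) → Dec (p ≡ q)
_≟ˢ_ = ≡-dec _≟ᵇ_

private
  variable
    k m n : ℕ

-- Counting subsets

countSubsets-mono : {P Q : Subset n → Set} (P? : Decidable P) (Q? : Decidable Q) →
                    (∀ S → P S → Q S) → countSubsets P? ≤ countSubsets Q?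
countSubsets-mono {zero} P? Q? P⇒Q with P? [] | Q? []
... | yes p | yes _ = ≤-refl
... | yes p | no ¬q = ⊥-elim (¬q (P⇒Q [] p))
... | no _  | _     = z≤n
countSubsets-mono {suc n} P? Q? P⇒Q =
  +-mono-≤ (countSubsets-mono (P? ∘ (inside ∷_)) (Q? ∘ (inside ∷_)) (P⇒Q ∘ (inside ∷_)))
           (countSubsets-mono (P? ∘ (outside ∷_)) (Q? ∘ (outside ∷_)) (P⇒Q ∘ (outside ∷_)))

+≤2* : ∀ {a b x} → a ≤ x → b ≤ x → a + b ≤ 2 * x
+≤2* {x = x} a≤x b≤x = +-mono-≤ a≤x (subst (_ ≤_) (sym (+-identityʳ x)) b≤x)

countSubsets≤2^n : {P : Subset n → Set} (P? : Decidable P) → countSubsets P? ≤ 2 ^ n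
countSubsets≤2^n {zero} P? with P? []
... | yes _ = ≤-refl
... | no _  = z≤n
countSubsets≤2^n {suc n} P? =
  +≤2* (countSubsets≤2^n (P? ∘ (inside ∷_))) (countSubsets≤2^n (P? ∘ (outside ∷_)))

countSubsets-universal : {P : Subset n → Set} (P? : Decidable P) →
                         (∀ S → P S) → 2 ^ n ≤ countSubsets P?
countSubsets-universal {zero} P? all with P? []
... | yes _ = ≤-refl
... | no ¬p = ⊥-elim (¬p (all []))
countSubsets-universal {suc n} P? all =
  +-mono-≤ (countSubsets-universal (P? ∘ (inside ∷_)) (all ∘ (inside ∷_)))
           (subst (_≤ countSubsets (P? ∘ (outside ∷_))) (sym (+-identityʳ _))
                  (countSubsets-universal (P? ∘ (outside ∷_)) (all ∘ (outside ∷_))))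

countSubsets-witness : {P : Subset n → Set} (P? : Decidable P) (S : Subset n) →
                       P S → 1 ≤ countSubsets P?
countSubsets-witness {zero} P? [] p with P? []
... | yes _ = ≤-refl
... | no ¬p = ⊥-elim (¬p p)
countSubsets-witness {suc n} P? (inside ∷ S) p =
  ≤-trans (countSubsets-witness (P? ∘ (inside ∷_)) S p) (m≤m+n _ _)
countSubsets-witness {suc n} P? (outside ∷ S) p =
  ≤-trans (countSubsets-witness (P? ∘ (outside ∷_)) S p) (m≤n+m _ _)

countSubsets-none : {P : Subset n → Set} (P? : Decidable P) →
                    (∀ S → ¬ P S) → countSubsets P? ≡ 0
countSubsets-none {zero} P? none with P? []
... | yes p = ⊥-elim (none [] p)
... | no _  = refl
countSubsets-none {suc n} P? none =
  cong₂ _+_ (countSubsets-none (P? ∘ (inside ∷_)) (none ∘ (inside ∷_)))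
            (countSubsets-none (P? ∘ (outside ∷_)) (none ∘ (outside ∷_)))

countSubsets-⊎ : {P Q R : Subset n → Set}
                 (P? : Decidable P) (Q? : Decidable Q) (R? : Decidable R) →
                 (∀ S → P S → Q S ⊎ R S) → countSubsets P? ≤ countSubsets Q? + countSubsets R?
countSubsets-⊎ {zero} P? Q? R? P⇒Q⊎R with P? [] | Q? [] | R? []
... | no _  | _     | _     = z≤n
... | yes _ | yes _ | _     = s≤s z≤n
... | yes _ | no _  | yes _ = s≤s z≤n
... | yes p | no ¬q | no ¬r with P⇒Q⊎R [] p
...   | inj₁ q = ⊥-elim (¬q q)
...   | inj₂ r = ⊥-elim (¬r r)
countSubsets-⊎ {suc n} P? Q? R? P⇒Q⊎R =
  subst (countSubsets P? ≤_)
        (interchange (countSubsets (Q? ∘ (inside ∷_))) (countSubsets (R? ∘ (inside ∷_)))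
                     (countSubsets (Q? ∘ (outside ∷_))) (countSubsets (R? ∘ (outside ∷_))))
        (+-mono-≤ (countSubsets-⊎ (P? ∘ (inside ∷_)) (Q? ∘ (inside ∷_)) (R? ∘ (inside ∷_))
                                  (P⇒Q⊎R ∘ (inside ∷_)))
                  (countSubsets-⊎ (P? ∘ (outside ∷_)) (Q? ∘ (outside ∷_)) (R? ∘ (outside ∷_))
                                  (P⇒Q⊎R ∘ (outside ∷_))))

countSubsets-disjoint : {P Q R : Subset n → Set}
                        (P? : Decidable P) (Q? : Decidable Q) (R? : Decidable R) →
                        (∀ S → P S → Q S → Empty) → (∀ S → P S → R S) → (∀ S → Q S → R S) →
                        countSubsets P? + countSubsets Q? ≤ countSubsets R?
countSubsets-disjoint {zero} P? Q? R? disjoint P⇒R Q⇒R with P? [] | Q? [] | R? []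
... | yes p | yes q | _     = ⊥-elim (disjoint [] p q)
... | yes _ | no _  | yes _ = ≤-refl
... | yes p | no _  | no ¬r = ⊥-elim (¬r (P⇒R [] p))
... | no _  | yes _ | yes _ = ≤-refl
... | no _  | yes q | no ¬r = ⊥-elim (¬r (Q⇒R [] q))
... | no _  | no _  | _     = z≤n
countSubsets-disjoint {suc n} P? Q? R? disjoint P⇒R Q⇒R =
  subst (_≤ countSubsets R?)
        (interchange (countSubsets (P? ∘ (inside ∷_))) (countSubsets (Q? ∘ (inside ∷_)))
                     (countSubsets (P? ∘ (outside ∷_))) (countSubsets (Q? ∘ (outside ∷_))))
        (+-mono-≤ (countSubsets-disjoint (P? ∘ (inside ∷_)) (Q? ∘ (inside ∷_)) (R? ∘ (inside ∷_))
                     (disjoint ∘ (inside ∷_)) (P⇒R ∘ (inside ∷_)) (Q⇒R ∘ (inside ∷_)))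
                  (countSubsets-disjoint (P? ∘ (outside ∷_)) (Q? ∘ (outside ∷_)) (R? ∘ (outside ∷_))
                     (disjoint ∘ (outside ∷_)) (P⇒R ∘ (outside ∷_)) (Q⇒R ∘ (outside ∷_))))

countSubsets-determined : {P : Subset n → Set} (P? : Decidable P) (U : Subset n) →
                          (∀ S T → P S → P T → U ∩ S ≡ U ∩ T → S ≡ T) →
                          countSubsets P? ≤ 2 ^ ∣ U ∣
countSubsets-determined {zero} P? [] _ = countSubsets≤2^n P?
countSubsets-determined {suc n} P? (inside ∷ U) det =
  +≤2* (countSubsets-determined (P? ∘ (inside ∷_)) U
          (λ S T p q eq → ∷-injectiveʳ (det (inside ∷ S) (inside ∷ T) p q (cong (inside ∷_) eq))))
       (countSubsets-determined (P? ∘ (outside ∷_)) U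
          (λ S T p q eq → ∷-injectiveʳ (det (outside ∷ S) (outside ∷ T) p q (cong (outside ∷_) eq))))
countSubsets-determined {suc n} {P} P? (outside ∷ U) det =
  ≤-trans (countSubsets-disjoint (P? ∘ (inside ∷_)) (P? ∘ (outside ∷_)) Either?
             (λ _ p q → inside≢outside (same p q refl)) (λ _ → inj₁) (λ _ → inj₂))
          (countSubsets-determined Either? U Either-det)
  where
  Either : Subset n → Set
  Either S = P (inside ∷ S) ⊎ P (outside ∷ S)
  Either? : Decidable Either
  Either? S = P? (inside ∷ S) ⊎-dec P? (outside ∷ S)
  inside≢outside : ∀ {S T : Subset n} → inside ∷ S ≢ outside ∷ T
  inside≢outside ()
  same : ∀ {s t S T} → P (s ∷ S) → P (t ∷ T) → U ∩ S ≡ U ∩ T → s ∷ S ≡ t ∷ T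
  same {s} {t} {S} {T} p q eq = det (s ∷ S) (t ∷ T) p q (cong (outside ∷_) eq)
  Either-det : ∀ S T → Either S → Either T → U ∩ S ≡ U ∩ T → S ≡ T
  Either-det S T (inj₁ p) (inj₁ q) eq = ∷-injectiveʳ (same p q eq)
  Either-det S T (inj₂ p) (inj₂ q) eq = ∷-injectiveʳ (same p q eq)
  Either-det S T (inj₁ p) (inj₂ q) eq = ⊥-elim (inside≢outside (same p q eq))
  Either-det S T (inj₂ p) (inj₁ q) eq = ⊥-elim (inside≢outside (sym (same p q eq)))

countSubsets≤1 : {P : Subset n → Set} (P? : Decidable P) →
                 (∀ S T → P S → P T → S ≡ T) → countSubsets P? ≤ 1
countSubsets≤1 {n} P? unique =
  subst (λ k → countSubsets P? ≤ 2 ^ k) (∣⊥∣≡0 n)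
        (countSubsets-determined P? ∅ (λ S T p q _ → unique S T p q))

countSubsets-⊆ : {P : Subset n → Set} (P? : Decidable P) (Y : Subset n) →
                 (∀ S → P S → S ⊆ Y) → countSubsets P? ≤ 2 ^ ∣ Y ∣
countSubsets-⊆ P? Y P⇒⊆Y = countSubsets-determined P? Y λ S T p q eq →
  trans (sym (trace (P⇒⊆Y S p))) (trans eq (trace (P⇒⊆Y T q)))
  where
  trace : ∀ {S} → S ⊆ Y → Y ∩ S ≡ S
  trace S⊆Y = ⊆-antisym (p∩q⊆q Y _) (λ x∈S → x∈p∩q⁺ (S⊆Y x∈S , x∈S))

countSubsets-⊆-empty : {P : Subset n → Set} (P? : Decidable P) (W : Subset n) →
                       ¬ Nonempty W → (∀ S → P S → S ⊆ W) → countSubsets P? ≤ 1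
countSubsets-⊆-empty {n} P? W W=∅ P⇒⊆W = begin
  countSubsets P? ≤⟨ countSubsets-⊆ P? W P⇒⊆W ⟩
  2 ^ ∣ W ∣       ≡⟨ cong (λ W → 2 ^ ∣ W ∣) (Empty-unique W=∅) ⟩
  2 ^ ∣ ∅ {n} ∣   ≡⟨ cong (2 ^_) (∣⊥∣≡0 n) ⟩
  1               ∎
  where open ≤-Reasoning

countSubsets-remove : {P Q : Subset n → Set} (P? : Decidable P) (Q? : Decidable Q) (u : Fin n) →
                      (∀ S → P S → u ∈ S) → (∀ S → P S → Q (S - u)) →
                      countSubsets P? ≤ countSubsets Q?
countSubsets-remove {suc n} {Q = Q} P? Q? zero u∈ P⇒Q = begin
  countSubsets (P? ∘ (inside ∷_)) + countSubsets (P? ∘ (outside ∷_))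
    ≡⟨ cong (countSubsets (P? ∘ (inside ∷_)) +_)
            (countSubsets-none (P? ∘ (outside ∷_)) (λ S p → zero∉ (u∈ _ p))) ⟩
  countSubsets (P? ∘ (inside ∷_)) + 0
    ≡⟨ +-identityʳ _ ⟩
  countSubsets (P? ∘ (inside ∷_))
    ≤⟨ countSubsets-mono (P? ∘ (inside ∷_)) (Q? ∘ (outside ∷_))
         (λ S p → subst (λ T → Q (outside ∷ T)) (p─⊥≡p S) (P⇒Q _ p)) ⟩
  countSubsets (Q? ∘ (outside ∷_))
    ≤⟨ m≤n+m _ _ ⟩
  countSubsets Q? ∎
  where
  open ≤-Reasoning
  zero∉ : ∀ {S : Subset n} → zero ∉ outside ∷ S
  zero∉ ()
countSubsets-remove {suc n} P? Q? (suc u) u∈ P⇒Q =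
  +-mono-≤ (countSubsets-remove (P? ∘ (inside ∷_)) (Q? ∘ (inside ∷_)) u
                                (λ _ → drop-there ∘ u∈ _) (P⇒Q ∘ (inside ∷_)))
           (countSubsets-remove (P? ∘ (outside ∷_)) (Q? ∘ (outside ∷_)) u
                                (λ _ → drop-there ∘ u∈ _) (P⇒Q ∘ (outside ∷_)))

countSubsets-fibre : {P Q : Subset n → Set} (P? : Decidable P) (Q? : Decidable Q) (X : Subset n) →
                     (∀ S → P S → Q (S ─ X)) → countSubsets P? ≤ 2 ^ ∣ X ∣ * countSubsets Q?
countSubsets-fibre {zero} P? Q? [] P⇒Q =
  subst (countSubsets P? ≤_) (sym (+-identityʳ _)) (countSubsets-mono P? Q? λ { [] → P⇒Q [] })
countSubsets-fibre {suc n} P? Q? (outside ∷ X) P⇒Q =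
  subst (countSubsets P? ≤_) (sym (*-distribˡ-+ (2 ^ ∣ X ∣) _ _))
        (+-mono-≤ (countSubsets-fibre (P? ∘ (inside ∷_)) (Q? ∘ (inside ∷_)) X (P⇒Q ∘ (inside ∷_)))
                  (countSubsets-fibre (P? ∘ (outside ∷_)) (Q? ∘ (outside ∷_)) X (P⇒Q ∘ (outside ∷_))))
countSubsets-fibre {suc n} P? Q? (inside ∷ X) P⇒Q = begin
  countSubsets P?
    ≤⟨ +-mono-≤ (countSubsets-fibre (P? ∘ (inside ∷_)) (Q? ∘ (outside ∷_)) X (P⇒Q ∘ (inside ∷_)))
                (countSubsets-fibre (P? ∘ (outside ∷_)) (Q? ∘ (outside ∷_)) X (P⇒Q ∘ (outside ∷_))) ⟩
  2 ^ ∣ X ∣ * q-out + 2 ^ ∣ X ∣ * q-out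
    ≡⟨ double-* (2 ^ ∣ X ∣) q-out ⟩
  2 ^ suc ∣ X ∣ * q-out
    ≤⟨ *-monoʳ-≤ (2 ^ suc ∣ X ∣) (m≤n+m q-out _) ⟩
  2 ^ suc ∣ X ∣ * countSubsets Q? ∎
  where
  open ≤-Reasoning
  q-out = countSubsets (Q? ∘ (outside ∷_))
  double-* : ∀ a b → a * b + a * b ≡ (2 * a) * b
  double-* = solve-∀

countSubsets-∁ : {P Q : Subset n → Set} (P? : Decidable P) (Q? : Decidable Q) →
                 (∀ S → P S → Q (∁ S)) → countSubsets P? ≤ countSubsets Q?
countSubsets-∁ {zero} P? Q? P⇒Q = countSubsets-mono P? Q? λ { [] → P⇒Q [] }
countSubsets-∁ {suc n} P? Q? P⇒Q =
  subst (countSubsets P? ≤_) (+-comm (countSubsets (Q? ∘ (outside ∷_))) _)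
        (+-mono-≤ (countSubsets-∁ (P? ∘ (inside ∷_)) (Q? ∘ (outside ∷_)) (P⇒Q ∘ (inside ∷_)))
                  (countSubsets-∁ (P? ∘ (outside ∷_)) (Q? ∘ (inside ∷_)) (P⇒Q ∘ (outside ∷_))))

countSubsets-++ : ∀ k {m} {P : Subset k → Set} {Q : Subset m → Set} {R : Subset (k + m) → Set}
                  (P? : Decidable P) (Q? : Decidable Q) (R? : Decidable R) →
                  (∀ S T → P S → Q T → R (S ++ T)) →
                  countSubsets P? * countSubsets Q? ≤ countSubsets R?
countSubsets-++ zero P? Q? R? P×Q⇒R with P? []
... | yes p = subst (_≤ countSubsets R?) (sym (+-identityʳ _))
                    (countSubsets-mono Q? R? (λ T → P×Q⇒R [] T p))
... | no _  = z≤n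
countSubsets-++ (suc k) P? Q? R? P×Q⇒R =
  subst (_≤ countSubsets R?)
        (sym (*-distribʳ-+ (countSubsets Q?) (countSubsets (P? ∘ (inside ∷_))) (countSubsets (P? ∘ (outside ∷_)))))
        (+-mono-≤ (countSubsets-++ k (P? ∘ (inside ∷_)) Q? (R? ∘ (inside ∷_)) (P×Q⇒R ∘ (inside ∷_)))
                  (countSubsets-++ k (P? ∘ (outside ∷_)) Q? (R? ∘ (outside ∷_)) (P×Q⇒R ∘ (outside ∷_))))

countSubsets-cover : {P : Subset n → Set} (P? : Decidable P) (f : Fin k → Fin n) (C : Subset k) (K : ℕ) →
                     (∀ S → P S → ∃ λ u → u ∈ C × f u ∈ S) →
                     (∀ u → u ∈ C → countSubsets (λ S → P? S ×-dec (f u ∈? S)) ≤ K) →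
                     countSubsets P? ≤ ∣ C ∣ * K
countSubsets-cover P? f [] K covered _ =
  ≤-reflexive (countSubsets-none P? (λ S p → fin0 (proj₁ (covered S p))))
  where
  fin0 : Fin 0 → Empty
  fin0 ()
countSubsets-cover {P = P} P? f (outside ∷ C) K covered bound =
  countSubsets-cover P? (f ∘ suc) C K covered′ (λ u → bound (suc u) ∘ there)
  where
  covered′ : ∀ S → P S → ∃ λ u → u ∈ C × f (suc u) ∈ S
  covered′ S p with covered S p
  ... | suc u , there u∈C , fu∈S = u , u∈C , fu∈S
countSubsets-cover {P = P} P? f (inside ∷ C) K covered bound =
  ≤-trans (countSubsets-⊎ P? (λ S → P? S ×-dec (f zero ∈? S)) Avoid? split)
          (+-mono-≤ (bound zero here) (countSubsets-cover Avoid? (f ∘ suc) C K covered′ bound′))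
  where
  Avoid : Subset _ → Set
  Avoid S = P S × f zero ∉ S
  Avoid? : Decidable Avoid
  Avoid? S = P? S ×-dec ¬? (f zero ∈? S)
  split : ∀ S → P S → (P S × f zero ∈ S) ⊎ Avoid S
  split S p with f zero ∈? S
  ... | yes f0∈S = inj₁ (p , f0∈S)
  ... | no f0∉S  = inj₂ (p , f0∉S)
  covered′ : ∀ S → Avoid S → ∃ λ u → u ∈ C × f (suc u) ∈ S
  covered′ S (p , f0∉S) with covered S p
  ... | zero , _ , f0∈S = ⊥-elim (f0∉S f0∈S)
  ... | suc u , there u∈C , fu∈S = u , u∈C , fu∈S
  bound′ : ∀ u → u ∈ C → countSubsets (λ S → Avoid? S ×-dec (f (suc u) ∈? S)) ≤ K
  bound′ u u∈C = ≤-trans (countSubsets-mono (λ S → Avoid? S ×-dec (f (suc u) ∈? S))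
                                            (λ S → P? S ×-dec (f (suc u) ∈? S))
                                            (λ _ ((p , _) , fu∈S) → p , fu∈S))
                         (bound (suc u) (there u∈C))

-- Finite sets

∣p─q∣+∣p∩q∣≡∣p∣ : (p q : Subset n) → ∣ p ─ q ∣ + ∣ p ∩ q ∣ ≡ ∣ p ∣
∣p─q∣+∣p∩q∣≡∣p∣ []            []            = refl
∣p─q∣+∣p∩q∣≡∣p∣ (inside ∷ p)  (inside ∷ q)  = trans (+-suc _ _) (cong suc (∣p─q∣+∣p∩q∣≡∣p∣ p q))
∣p─q∣+∣p∩q∣≡∣p∣ (inside ∷ p)  (outside ∷ q) = cong suc (∣p─q∣+∣p∩q∣≡∣p∣ p q)
∣p─q∣+∣p∩q∣≡∣p∣ (outside ∷ p) (inside ∷ q)  = ∣p─q∣+∣p∩q∣≡∣p∣ p q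
∣p─q∣+∣p∩q∣≡∣p∣ (outside ∷ p) (outside ∷ q) = ∣p─q∣+∣p∩q∣≡∣p∣ p q

∣p∩q∣+∣p∩∁q∣≡∣p∣ : (p q : Subset n) → ∣ p ∩ q ∣ + ∣ p ∩ ∁ q ∣ ≡ ∣ p ∣
∣p∩q∣+∣p∩∁q∣≡∣p∣ []            []            = refl
∣p∩q∣+∣p∩∁q∣≡∣p∣ (inside ∷ p)  (inside ∷ q)  = cong suc (∣p∩q∣+∣p∩∁q∣≡∣p∣ p q)
∣p∩q∣+∣p∩∁q∣≡∣p∣ (inside ∷ p)  (outside ∷ q) = trans (+-suc _ _) (cong suc (∣p∩q∣+∣p∩∁q∣≡∣p∣ p q))
∣p∩q∣+∣p∩∁q∣≡∣p∣ (outside ∷ p) (_ ∷ q)       = ∣p∩q∣+∣p∩∁q∣≡∣p∣ p q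

∣p─q∣≡∣p∣∸∣p∩q∣ : (p q : Subset n) → ∣ p ─ q ∣ ≡ ∣ p ∣ ∸ ∣ p ∩ q ∣
∣p─q∣≡∣p∣∸∣p∩q∣ p q =
  trans (sym (m+n∸n≡m ∣ p ─ q ∣ ∣ p ∩ q ∣)) (cong (_∸ ∣ p ∩ q ∣) (∣p─q∣+∣p∩q∣≡∣p∣ p q))

x∈p─q⁻ : ∀ {x : Fin n} (p q : Subset n) → x ∈ p ─ q → x ∈ p × x ∉ q
x∈p─q⁻ p q x∈p─q = p─q⊆p p q x∈p─q , x∉q p q x∈p─q
  where
  x∉q : ∀ {n} {x : Fin n} (p q : Subset n) → x ∈ p ─ q → x ∉ q
  x∉q (_ ∷ p) (_ ∷ q) (there x∈p─q) (there x∈q) = x∉q p q x∈p─q x∈q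

x∈p-y⁻ : ∀ {x y : Fin n} (p : Subset n) → x ∈ p - y → x ∈ p × x ≢ y
x∈p-y⁻ {y = y} p x∈p-y =
  let x∈p , x∉⁅y⁆ = x∈p─q⁻ p ⁅ y ⁆ x∈p-y in x∈p , x∉⁅y⁆⇒x≢y x∉⁅y⁆

x∈p⇒1≤∣p∣ : ∀ {x : Fin n} {p : Subset n} → x ∈ p → 1 ≤ ∣ p ∣
x∈p⇒1≤∣p∣ {p = inside ∷ p} here = s≤s z≤n
x∈p⇒1≤∣p∣ {p = s ∷ p} (there x∈p) = ≤-trans (x∈p⇒1≤∣p∣ x∈p) (∣p∣≤∣x∷p∣ s p)

1≤∣p∣⇒Nonempty : (p : Subset n) → 1 ≤ ∣ p ∣ → Nonempty p
1≤∣p∣⇒Nonempty (inside ∷ p)  _     = zero , here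
1≤∣p∣⇒Nonempty (outside ∷ p) 1≤∣p∣ = let x , x∈p = 1≤∣p∣⇒Nonempty p 1≤∣p∣ in suc x , there x∈p

∣p∩⊥∣≡0 : (p : Subset n) → ∣ p ∩ ∅ ∣ ≡ 0
∣p∩⊥∣≡0 {n} p = trans (cong ∣_∣ (∩-zeroʳ p)) (∣⊥∣≡0 n)

∣⊥∩p∣≡0 : (p : Subset n) → ∣ ∅ ∩ p ∣ ≡ 0
∣⊥∩p∣≡0 {n} p = trans (cong ∣_∣ (∩-zeroˡ p)) (∣⊥∣≡0 n)

Empty⇒∣p∣≡0 : {p : Subset n} → ¬ Nonempty p → ∣ p ∣ ≡ 0
Empty⇒∣p∣≡0 {n} p=∅ = trans (cong ∣_∣ (Empty-unique p=∅)) (∣⊥∣≡0 n)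

x∈p⇒∣p∣≡1+∣p-x∣ : ∀ {x : Fin n} {p : Subset n} → x ∈ p → ∣ p ∣ ≡ suc ∣ p - x ∣
x∈p⇒∣p∣≡1+∣p-x∣ {p = inside ∷ p} here = cong (suc ∘ ∣_∣) (sym (p─⊥≡p p))
x∈p⇒∣p∣≡1+∣p-x∣ {p = inside ∷ p} (there x∈p) = cong suc (x∈p⇒∣p∣≡1+∣p-x∣ x∈p)
x∈p⇒∣p∣≡1+∣p-x∣ {p = outside ∷ p} (there x∈p) = x∈p⇒∣p∣≡1+∣p-x∣ x∈p

2≤∣p∣ : ∀ {x y : Fin n} {p : Subset n} → x ∈ p → y ∈ p → x ≢ y → 2 ≤ ∣ p ∣
2≤∣p∣ {p = p} x∈p y∈p x≢y =
  subst (2 ≤_) (sym (x∈p⇒∣p∣≡1+∣p-x∣ x∈p)) (s≤s (x∈p⇒1≤∣p∣ (x∈p∧x≢y⇒x∈p-y y∈p (x≢y ∘ sym))))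

3≤∣p∣ : ∀ {x y z : Fin n} {p : Subset n} → x ∈ p → y ∈ p → z ∈ p → x ≢ y → x ≢ z → y ≢ z → 3 ≤ ∣ p ∣
3≤∣p∣ x∈p y∈p z∈p x≢y x≢z y≢z =
  subst (3 ≤_) (sym (x∈p⇒∣p∣≡1+∣p-x∣ x∈p))
        (s≤s (2≤∣p∣ (x∈p∧x≢y⇒x∈p-y y∈p (x≢y ∘ sym)) (x∈p∧x≢y⇒x∈p-y z∈p (x≢z ∘ sym)) y≢z))

∣p∩q∣≡∣p∣⇒p⊆q : (p q : Subset n) → ∣ p ∩ q ∣ ≡ ∣ p ∣ → p ⊆ q
∣p∩q∣≡∣p∣⇒p⊆q p q eq {x} x∈p with x ∈? q
... | yes x∈q = x∈q
... | no x∉q  = ⊥-elim (1+n≰n (begin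
  1 + ∣ p ∣                  ≤⟨ +-monoˡ-≤ ∣ p ∣ (x∈p⇒1≤∣p∣ (x∈p∩q⁺ (x∈p , x∉p⇒x∈∁p x∉q))) ⟩
  ∣ p ∩ ∁ q ∣ + ∣ p ∣         ≡⟨ cong (∣ p ∩ ∁ q ∣ +_) (sym eq) ⟩
  ∣ p ∩ ∁ q ∣ + ∣ p ∩ q ∣     ≡⟨ +-comm ∣ p ∩ ∁ q ∣ ∣ p ∩ q ∣ ⟩
  ∣ p ∩ q ∣ + ∣ p ∩ ∁ q ∣     ≡⟨ ∣p∩q∣+∣p∩∁q∣≡∣p∣ p q ⟩
  ∣ p ∣                      ∎))
  where open ≤-Reasoning

w∉p⇒p∩[q∪⁅w⁆]≡p∩q : ∀ {p q : Subset n} {w} → w ∉ p → p ∩ (q ∪ ⁅ w ⁆) ≡ p ∩ q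
w∉p⇒p∩[q∪⁅w⁆]≡p∩q {p = p} {q} {w} w∉p = ⊆-antisym ⊆∩ ∩⊆
  where
  ⊆∩ : p ∩ (q ∪ ⁅ w ⁆) ⊆ p ∩ q
  ⊆∩ x∈ with x∈p∩q⁻ p (q ∪ ⁅ w ⁆) x∈
  ... | x∈p , x∈q∪⁅w⁆ with x∈p∪q⁻ q ⁅ w ⁆ x∈q∪⁅w⁆
  ...   | inj₁ x∈q = x∈p∩q⁺ (x∈p , x∈q)
  ...   | inj₂ x∈⁅w⁆ rewrite x∈⁅y⁆⇒x≡y w x∈⁅w⁆ = ⊥-elim (w∉p x∈p)
  ∩⊆ : p ∩ q ⊆ p ∩ (q ∪ ⁅ w ⁆)
  ∩⊆ x∈ = let x∈p , x∈q = x∈p∩q⁻ p q x∈ in x∈p∩q⁺ (x∈p , p⊆p∪q ⁅ w ⁆ x∈q)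

∃-minimiser : (f : Fin n → ℕ) (W : Subset n) → Nonempty W →
              ∃ λ v → v ∈ W × (∀ {u} → u ∈ W → f v ≤ f u)
∃-minimiser {suc n} f (s ∷ W) (x , x∈W) with nonempty? W
... | yes W≠∅ = extend s (∃-minimiser (f ∘ suc) W W≠∅) x∈W
  where
  extend : ∀ s → (∃ λ v → v ∈ W × (∀ {u} → u ∈ W → f (suc v) ≤ f (suc u))) → x ∈ s ∷ W →
           ∃ λ v → v ∈ s ∷ W × (∀ {u} → u ∈ s ∷ W → f v ≤ f u)
  extend outside (v , v∈W , min) _ = suc v , there v∈W , λ { (there u∈W) → min u∈W }
  extend inside (v , v∈W , min) _ with f zero ≤? f (suc v)
  ... | yes f0≤fv = zero , here , λ { here → ≤-refl ; (there u∈W) → ≤-trans f0≤fv (min u∈W) }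
  ... | no f0≰fv  = suc v , there v∈W , λ { here → <⇒≤ (≰⇒> f0≰fv) ; (there u∈W) → min u∈W }
... | no W=∅ with x∈W
...   | here = zero , here , λ { here → ≤-refl ; (there u∈W) → ⊥-elim (W=∅ (_ , u∈W)) }
...   | there x∈W′ = ⊥-elim (W=∅ (_ , x∈W′))

∃-maximal : {P : Subset n → Set} (P? : Decidable P) (S : Subset n) → P S →
            ∃ λ I → P I × ¬ (∃ λ T → I ⊂ T × P T)
∃-maximal {n} {P} P? S p = go n S p (m≤n+m n ∣ S ∣)
  where
  go : ∀ fuel S → P S → n ≤ ∣ S ∣ + fuel → ∃ λ I → P I × ¬ (∃ λ T → I ⊂ T × P T)
  go fuel S p _ with anySubset? (λ T → (S ⊂? T) ×-dec P? T)
  ... | no maximal = S , p , maximal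
  go zero S _ n≤∣S∣ | yes (T , S⊂T , _) =
    ⊥-elim (<⇒≱ (≤-trans (p⊂q⇒∣p∣<∣q∣ S⊂T) (∣p∣≤n T)) (subst (n ≤_) (+-identityʳ _) n≤∣S∣))
  go (suc fuel) S _ n≤∣S∣+1+fuel | yes (T , S⊂T , q) =
    go fuel T q (≤-trans n≤∣S∣+1+fuel (subst (_≤ ∣ T ∣ + fuel) (sym (+-suc ∣ S ∣ fuel))
                                              (+-monoˡ-≤ fuel (p⊂q⇒∣p∣<∣q∣ S⊂T))))

⟦_⟧ : {P : Fin n → Set} → Decidable P → Subset n
⟦ P? ⟧ = tabulate (does ∘ P?)

∈⟦⟧⁺ : {P : Fin n → Set} (P? : Decidable P) {x : Fin n} → P x → x ∈ ⟦ P? ⟧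
∈⟦⟧⁺ P? {x} px = lookup⇒[]= x _ (trans (lookup∘tabulate (does ∘ P?) x) (dec-true (P? x) px))

∈⟦⟧⁻ : {P : Fin n → Set} (P? : Decidable P) {x : Fin n} → x ∈ ⟦ P? ⟧ → P x
∈⟦⟧⁻ P? {x} x∈ with P? x | trans (sym (lookup∘tabulate (does ∘ P?) x)) ([]=⇒lookup x∈)
... | yes px | _  = px
... | no _   | ()

-- The Moon–Moser numbers and the independence bound

moonMoser : ℕ → ℕ
moonMoser 0 = 1
moonMoser 1 = 1
moonMoser 2 = 2
moonMoser 3 = 3
moonMoser 4 = 4
moonMoser (suc (suc (suc (suc (suc n))))) = 3 * moonMoser (suc (suc n))

private
  by-computation : ∀ m n → {T (m ≤ᵇ n)} → m ≤ n
  by-computation m n {m≤n} = ≤ᵇ⇒≤ m n m≤n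

  *-3-comm : ∀ a x → a * (3 * x) ≡ 3 * (a * x)
  *-3-comm = solve-∀

moonMoser-step : ∀ n → moonMoser n ≤ moonMoser (suc n)
moonMoser-step 0 = by-computation 1 1
moonMoser-step 1 = by-computation 1 2
moonMoser-step 2 = by-computation 2 3
moonMoser-step 3 = by-computation 3 4
moonMoser-step 4 = by-computation 4 6
moonMoser-step (suc (suc (suc (suc (suc n))))) = *-monoʳ-≤ 3 (moonMoser-step (suc (suc n)))

moonMoser-mono : ∀ {m n} → m ≤ n → moonMoser m ≤ moonMoser n
moonMoser-mono {n = zero} z≤n = ≤-refl
moonMoser-mono {m} {suc n} m≤1+n with m≤n⇒m<n∨m≡n m≤1+n
... | inj₂ refl      = ≤-refl
... | inj₁ (s≤s m≤n) = ≤-trans (moonMoser-mono m≤n) (moonMoser-step n)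

moonMoser-2* : ∀ n → 2 * moonMoser n ≤ moonMoser (2 + n)
moonMoser-2* 0 = by-computation 2 2
moonMoser-2* 1 = by-computation 2 3
moonMoser-2* 2 = by-computation 4 4
moonMoser-2* 3 = by-computation 6 6
moonMoser-2* 4 = by-computation 8 9
moonMoser-2* (suc (suc (suc (suc (suc n))))) =
  ≤-trans (≤-reflexive (*-3-comm 2 (moonMoser (suc (suc n))))) (*-monoʳ-≤ 3 (moonMoser-2* (suc (suc n))))

moonMoser-3* : ∀ n → 3 * moonMoser n ≤ moonMoser (3 + n)
moonMoser-3* 0 = by-computation 3 3
moonMoser-3* 1 = by-computation 3 4
moonMoser-3* 2 = by-computation 6 6
moonMoser-3* 3 = by-computation 9 9
moonMoser-3* 4 = by-computation 12 12
moonMoser-3* (suc (suc (suc (suc (suc n))))) =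
  ≤-trans (≤-reflexive (*-3-comm 3 (moonMoser (suc (suc n))))) (*-monoʳ-≤ 3 (moonMoser-3* (suc (suc n))))

moonMoser-4* : ∀ n → 4 * moonMoser n ≤ moonMoser (4 + n)
moonMoser-4* 0 = by-computation 4 4
moonMoser-4* 1 = by-computation 4 6
moonMoser-4* 2 = by-computation 8 9
moonMoser-4* 3 = by-computation 12 12
moonMoser-4* 4 = by-computation 16 18
moonMoser-4* (suc (suc (suc (suc (suc n))))) =
  ≤-trans (≤-reflexive (*-3-comm 4 (moonMoser (suc (suc n))))) (*-monoʳ-≤ 3 (moonMoser-4* (suc (suc n))))

moonMoser-* : ∀ d n → suc d * moonMoser n ≤ moonMoser (suc d + n)
moonMoser-* 0 n = subst (_≤ moonMoser (suc n)) (sym (+-identityʳ _)) (moonMoser-step n)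
moonMoser-* 1 n = moonMoser-2* n
moonMoser-* 2 n = moonMoser-3* n
moonMoser-* 3 n = moonMoser-4* n
moonMoser-* (suc (suc (suc (suc d)))) n = begin
  (5 + d) * moonMoser n     ≤⟨ *-monoˡ-≤ (moonMoser n) (5+d≤3*[2+d] d) ⟩
  3 * (2 + d) * moonMoser n ≡⟨ *-assoc 3 (2 + d) (moonMoser n) ⟩
  3 * ((2 + d) * moonMoser n) ≤⟨ *-monoʳ-≤ 3 (moonMoser-* (suc d) n) ⟩
  moonMoser (5 + d + n)     ∎
  where
  open ≤-Reasoning
  5+d≤3*[2+d] : ∀ d → 5 + d ≤ 3 * (2 + d)
  5+d≤3*[2+d] d = subst (5 + d ≤_) (sym (3*[2+d] d)) (+-monoʳ-≤ 5 (m≤m+n d _))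
    where
    3*[2+d] : ∀ d → 3 * (2 + d) ≡ 5 + (d + (1 + d + d))
    3*[2+d] = solve-∀

moonMoser-∸ : ∀ {d n} → 1 ≤ d → d ≤ n → d * moonMoser (n ∸ d) ≤ moonMoser n
moonMoser-∸ {suc d} {n} _ d<n =
  subst (λ m → suc d * moonMoser (n ∸ suc d) ≤ moonMoser m) (m+[n∸m]≡n d<n)
        (moonMoser-* d (n ∸ suc d))

1≤moonMoser : ∀ n → 1 ≤ moonMoser n
1≤moonMoser n = moonMoser-mono {0} {n} z≤n

moonMoser-3t : ∀ t → moonMoser (t * 3) ≡ 3 ^ t
moonMoser-3t 0 = refl
moonMoser-3t 1 = refl
moonMoser-3t (suc (suc t)) = cong (3 *_) (moonMoser-3t (suc t))

moonMoser-2+3t : ∀ t → moonMoser (2 + t * 3) ≡ 2 * 3 ^ t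
moonMoser-2+3t 0 = refl
moonMoser-2+3t (suc t) = trans (cong (3 *_) (moonMoser-2+3t t)) (sym (*-3-comm 2 (3 ^ t)))

moonMoser-4+3t : ∀ t → moonMoser (4 + t * 3) ≡ 4 * 3 ^ t
moonMoser-4+3t 0 = refl
moonMoser-4+3t (suc t) = trans (cong (3 *_) (moonMoser-4+3t t)) (sym (*-3-comm 4 (3 ^ t)))

[2+n]/2≡1+n/2 : ∀ n → (2 + n) / 2 ≡ 1 + n / 2
[2+n]/2≡1+n/2 n = m/n≡1+[m∸n]/n {2 + n} {2} (s≤s (s≤s z≤n))

independenceBound : ℕ → ℕ
independenceBound 0 = 1
independenceBound 1 = 1
independenceBound (suc (suc n)) = 1 + 2 ^ suc n

1≤independenceBound : ∀ n → 1 ≤ independenceBound n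
1≤independenceBound 0 = ≤-refl
1≤independenceBound 1 = ≤-refl
1≤independenceBound (suc (suc n)) = m≤m+n 1 _

independenceBound-edge : ∀ a b c → b < a → c < a →
                         2 ^ b + (2 ^ c + 2 ^ a) ≤ independenceBound (2 + a)
independenceBound-edge (suc k) b c (s≤s b≤k) (s≤s c≤k) = begin
  2 ^ b + (2 ^ c + 2 ^ suc k)          ≤⟨ +-mono-≤ (^-monoʳ-≤ 2 b≤k) (+-monoˡ-≤ (2 ^ suc k) (^-monoʳ-≤ 2 c≤k)) ⟩
  2 ^ k + (2 ^ k + 2 * 2 ^ k)          ≡⟨ 4* (2 ^ k) ⟩
  2 ^ suc (suc k)                      ≤⟨ m≤n+m _ 1 ⟩
  independenceBound (2 + suc k)        ∎
  where
  open ≤-Reasoning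
  4* : ∀ x → x + (x + 2 * x) ≡ 2 * (2 * x)
  4* = solve-∀

independenceBound-star : ∀ j e → 1 ≤ e →
                         independenceBound j + 2 ^ e * independenceBound j ≤ independenceBound (j + suc e)
independenceBound-star 0 (suc d) _ = ≤-reflexive (cong (1 +_) (*-identityʳ (2 ^ suc d)))
independenceBound-star 1 (suc d) _ =
  +-monoʳ-≤ 1 (≤-trans (≤-reflexive (*-identityʳ (2 ^ suc d))) (^-monoʳ-≤ 2 (n≤1+n (suc d))))
independenceBound-star (suc (suc k)) (suc d) _ = begin
  (1 + 2 * x) + 2 * y * (1 + 2 * x)    ≤⟨ product-bound (m^n>0 2 k) (m^n>0 2 d) ⟩
  1 + (2 * x) * (2 * (2 * y))          ≡⟨ cong (1 +_) (sym (^-distribˡ-+-* 2 (suc k) (suc (suc d)))) ⟩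
  independenceBound (suc (suc k) + suc (suc d)) ∎
  where
  open ≤-Reasoning
  x = 2 ^ k
  y = 2 ^ d
  product-bound : ∀ {x y} → 1 ≤ x → 1 ≤ y → (1 + 2 * x) + 2 * y * (1 + 2 * x) ≤ 1 + (2 * x) * (2 * (2 * y))
  product-bound {suc a} {suc b} _ _ = ≤-trans (m≤m+n _ _) (≤-reflexive (sym (slack a b)))
    where
    slack : ∀ a b → 1 + (2 * suc a) * (2 * (2 * suc b))
                  ≡ ((1 + 2 * suc a) + 2 * suc b * (1 + 2 * suc a)) + (4 * a * b + 2 * a + 2 * b)
    slack = solve-∀

-- Graphs: maximal independent sets, independent sets and small dominating sets

module Graph {n : ℕ} (Adj : Fin n → Fin n → Set) (Adj? : ∀ x y → Dec (Adj x y))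
             (Adj-sym : ∀ {x y} → Adj x y → Adj y x) (Adj-irrefl : ∀ {x} → ¬ Adj x x) where

  Adj⇒≢ : ∀ {x y} → Adj x y → x ≢ y
  Adj⇒≢ a refl = Adj-irrefl a

  N[_] : Fin n → Subset n
  N[ u ] = ⁅ u ⁆ ∪ ⟦ Adj? u ⟧

  u∈N[u] : ∀ u → u ∈ N[ u ]
  u∈N[u] u = x∈p∪q⁺ (inj₁ (x∈⁅x⁆ u))

  Adj⇒∈N : ∀ {u x} → Adj u x → x ∈ N[ u ]
  Adj⇒∈N a = x∈p∪q⁺ (inj₂ (∈⟦⟧⁺ (Adj? _) a))

  ∈N⁻ : ∀ {u x} → x ∈ N[ u ] → x ≡ u ⊎ Adj u x
  ∈N⁻ {u} x∈N with x∈p∪q⁻ ⁅ u ⁆ _ x∈N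
  ... | inj₁ x∈⁅u⁆ = inj₁ (x∈⁅y⁆⇒x≡y u x∈⁅u⁆)
  ... | inj₂ x∈Nu  = inj₂ (∈⟦⟧⁻ (Adj? u) x∈Nu)

  closedDegree : Subset n → Fin n → ℕ
  closedDegree W u = ∣ W ∩ N[ u ] ∣

  Independent : Subset n → Set
  Independent S = ∀ x y → x ∈ S → y ∈ S → ¬ Adj x y

  Independent? : Decidable Independent
  Independent? S = all? λ x → all? λ y → (x ∈? S) →-dec ((y ∈? S) →-dec ¬? (Adj? x y))

  Dominates : Subset n → Subset n → Set
  Dominates W S = ∀ x → x ∈ W → x ∉ S → ∃ λ y → y ∈ S × Adj x y

  Dominates? : ∀ W → Decidable (Dominates W)
  Dominates? W S = all? λ x → (x ∈? W) →-dec (¬? (x ∈? S) →-dec any? λ y → (y ∈? S) ×-dec Adj? x y)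

  IndependentIn : Subset n → Subset n → Set
  IndependentIn W S = S ⊆ W × Independent S

  IndependentIn? : ∀ W → Decidable (IndependentIn W)
  IndependentIn? W S = (S ⊆? W) ×-dec Independent? S

  MaximalIndependentIn : Subset n → Subset n → Set
  MaximalIndependentIn W S = IndependentIn W S × Dominates W S

  MaximalIndependentIn? : ∀ W → Decidable (MaximalIndependentIn W)
  MaximalIndependentIn? W S = IndependentIn? W S ×-dec Dominates? W S

  NoIsolatedIn : Subset n → Set
  NoIsolatedIn W = ∀ x → x ∈ W → ∃ λ y → y ∈ W × Adj x y

  independentIn-remove : ∀ {W S u} → IndependentIn W S → u ∈ S → IndependentIn (W ─ N[ u ]) (S - u)
  independentIn-remove {W} {S} {u} (S⊆W , indep) u∈S = S-u⊆W─N[u] , indep′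
    where
    S-u⊆W─N[u] : S - u ⊆ W ─ N[ u ]
    S-u⊆W─N[u] {x} x∈S-u with x∈p-y⁻ S x∈S-u
    ... | x∈S , x≢u = x∈p∧x∉q⇒x∈p─q (S⊆W x∈S) λ x∈N[u] → case ∈N⁻ x∈N[u] of λ where
      (inj₁ x≡u) → x≢u x≡u
      (inj₂ u~x) → indep u x u∈S x∈S u~x
    indep′ : Independent (S - u)
    indep′ x y x∈ y∈ = indep x y (proj₁ (x∈p-y⁻ S x∈)) (proj₁ (x∈p-y⁻ S y∈))

  maximalIndependentIn-remove : ∀ {W S u} → MaximalIndependentIn W S → u ∈ S →
                                MaximalIndependentIn (W ─ N[ u ]) (S - u)
  maximalIndependentIn-remove {W} {S} {u} (indep , dom) u∈S = independentIn-remove indep u∈S , dom′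
    where
    dom′ : Dominates (W ─ N[ u ]) (S - u)
    dom′ x x∈W─N[u] x∉S-u with x∈p─q⁻ W N[ u ] x∈W─N[u]
    ... | x∈W , x∉N[u] with x ∈? S
    ...   | yes x∈S = ⊥-elim (x∉S-u (x∈p∧x≢y⇒x∈p-y x∈S λ { refl → x∉N[u] (u∈N[u] u) }))
    ...   | no x∉S with dom x x∈W x∉S
    ...     | y , y∈S , x~y =
      y , x∈p∧x≢y⇒x∈p-y y∈S (λ { refl → x∉N[u] (Adj⇒∈N (Adj-sym x~y)) }) , x~y

  countMaximalIndependent≤moonMoser : ∀ fuel W → ∣ W ∣ ≤ fuel →
                                      countSubsets (MaximalIndependentIn? W) ≤ moonMoser ∣ W ∣
  countMaximalIndependent≤moonMoser fuel W _ with nonempty? W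
  ... | no W=∅ = ≤-trans (countSubsets-⊆-empty _ W W=∅ (λ _ → proj₁ ∘ proj₁)) (1≤moonMoser ∣ W ∣)
  countMaximalIndependent≤moonMoser zero W ∣W∣≤0 | yes (x , x∈W) =
    ⊥-elim (1+n≰n (≤-trans (x∈p⇒1≤∣p∣ x∈W) ∣W∣≤0))
  countMaximalIndependent≤moonMoser (suc fuel) W ∣W∣≤1+fuel | yes W≠∅
    with ∃-minimiser (closedDegree W) W W≠∅
  ... | v , v∈W , v-min = begin
    countSubsets (MaximalIndependentIn? W)
      ≤⟨ countSubsets-cover _ id (W ∩ N[ v ]) (moonMoser (∣ W ∣ ∸ closedDegree W v)) covers bound ⟩
    closedDegree W v * moonMoser (∣ W ∣ ∸ closedDegree W v)
      ≤⟨ moonMoser-∸ (x∈p⇒1≤∣p∣ (x∈p∩q⁺ (v∈W , u∈N[u] v))) (∣p∩q∣≤∣p∣ W N[ v ]) ⟩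
    moonMoser ∣ W ∣ ∎
    where
    open ≤-Reasoning
    covers : ∀ S → MaximalIndependentIn W S → ∃ λ u → u ∈ W ∩ N[ v ] × u ∈ S
    covers S ((S⊆W , _) , dom) with v ∈? S
    ... | yes v∈S = v , x∈p∩q⁺ (v∈W , u∈N[u] v) , v∈S
    ... | no v∉S with dom v v∈W v∉S
    ...   | y , y∈S , v~y = y , x∈p∩q⁺ (S⊆W y∈S , Adj⇒∈N v~y) , y∈S
    bound : ∀ u → u ∈ W ∩ N[ v ] → countSubsets (λ S → MaximalIndependentIn? W S ×-dec (u ∈? S))
                                  ≤ moonMoser (∣ W ∣ ∸ closedDegree W v)
    bound u u∈W∩N[v] = begin
      countSubsets (λ S → MaximalIndependentIn? W S ×-dec (u ∈? S))
        ≤⟨ countSubsets-remove _ (MaximalIndependentIn? (W ─ N[ u ])) u (λ _ → proj₂)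
                               (λ _ (mis , u∈S) → maximalIndependentIn-remove mis u∈S) ⟩
      countSubsets (MaximalIndependentIn? (W ─ N[ u ]))
        ≤⟨ countMaximalIndependent≤moonMoser fuel (W ─ N[ u ]) ∣W─N[u]∣≤fuel ⟩
      moonMoser ∣ W ─ N[ u ] ∣
        ≤⟨ moonMoser-mono (≤-trans (≤-reflexive ∣W─N[u]∣≡) (∸-monoʳ-≤ ∣ W ∣ (v-min u∈W))) ⟩
      moonMoser (∣ W ∣ ∸ closedDegree W v) ∎
      where
      u∈W : u ∈ W
      u∈W = proj₁ (x∈p∩q⁻ W N[ v ] u∈W∩N[v])
      ∣W─N[u]∣≡ : ∣ W ─ N[ u ] ∣ ≡ ∣ W ∣ ∸ closedDegree W u
      ∣W─N[u]∣≡ = ∣p─q∣≡∣p∣∸∣p∩q∣ W N[ u ]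
      ∣W─N[u]∣≤fuel : ∣ W ─ N[ u ] ∣ ≤ fuel
      ∣W─N[u]∣≤fuel = ≤-trans (≤-reflexive ∣W─N[u]∣≡)
                        (∸-mono ∣W∣≤1+fuel (x∈p⇒1≤∣p∣ (x∈p∩q⁺ (u∈W , u∈N[u] u))))

  Heavy : Subset n → Fin n → Set
  Heavy W x = 3 ≤ closedDegree W x

  HeavyEdge : Subset n → Set
  HeavyEdge W = ∃ λ u → ∃ λ v → u ∈ W × v ∈ W × Adj u v × Heavy W u × Heavy W v

  HeavyEdge? : Decidable HeavyEdge
  HeavyEdge? W = any? λ u → any? λ v → (u ∈? W) ×-dec (v ∈? W) ×-dec Adj? u v ×-dec
                                       (3 ≤? closedDegree W u) ×-dec (3 ≤? closedDegree W v)

  leaf-unique : ∀ {W x c y} → x ∈ W → ¬ Heavy W x → c ∈ W → Adj x c → y ∈ W → Adj x y → y ≡ c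
  leaf-unique {x = x} {c} {y} x∈W light c∈W x~c y∈W x~y with y ≟ᶠ c
  ... | yes y≡c = y≡c
  ... | no y≢c  = ⊥-elim (light (3≤∣p∣ (x∈p∩q⁺ (x∈W , u∈N[u] x)) (x∈p∩q⁺ (c∈W , Adj⇒∈N x~c))
                                       (x∈p∩q⁺ (y∈W , Adj⇒∈N x~y))
                                       (Adj⇒≢ x~c) (Adj⇒≢ x~y) (y≢c ∘ sym)))

  Containing? : ∀ W w → Decidable (λ S → IndependentIn W S × w ∈ S)
  Containing? W w S = IndependentIn? W S ×-dec (w ∈? S)

  Avoiding? : ∀ W w → Decidable (λ S → IndependentIn W S × w ∉ S)
  Avoiding? W w S = IndependentIn? W S ×-dec ¬? (w ∈? S)

  countIndependent-split : ∀ W w →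
    countSubsets (IndependentIn? W) ≤ countSubsets (Containing? W w) + countSubsets (Avoiding? W w)
  countIndependent-split W w = countSubsets-⊎ _ (Containing? W w) (Avoiding? W w) split
    where
    split : ∀ S → IndependentIn W S → (IndependentIn W S × w ∈ S) ⊎ (IndependentIn W S × w ∉ S)
    split S indep with w ∈? S
    ... | yes w∈S = inj₁ (indep , w∈S)
    ... | no w∉S  = inj₂ (indep , w∉S)

  countContaining≤ : ∀ W w → countSubsets (Containing? W w) ≤ 2 ^ ∣ W ─ N[ w ] ∣
  countContaining≤ W w =
    ≤-trans (countSubsets-remove _ (_⊆? W ─ N[ w ]) w (λ _ → proj₂)
                                 (λ _ (indep , w∈S) → proj₁ (independentIn-remove indep w∈S)))
            (countSubsets-⊆ (_⊆? W ─ N[ w ]) (W ─ N[ w ]) (λ _ → id))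

  countIndependent-heavyEdge : ∀ {W u v} → u ∈ W → v ∈ W → Adj u v → Heavy W u → Heavy W v →
                               countSubsets (IndependentIn? W) ≤ independenceBound ∣ W ∣
  countIndependent-heavyEdge {W} {u} {v} u∈W v∈W u~v heavy-u heavy-v = begin
    countSubsets (IndependentIn? W)
      ≤⟨ countIndependent-split W u ⟩
    countSubsets (Containing? W u) + countSubsets (Avoiding? W u)
      ≤⟨ +-monoʳ-≤ (countSubsets (Containing? W u)) (countSubsets-⊎ _ (Containing? W v) neither? split) ⟩
    countSubsets (Containing? W u) + (countSubsets (Containing? W v) + countSubsets neither?)
      ≤⟨ +-mono-≤ (countContaining≤ W u)
                  (+-mono-≤ (countContaining≤ W v) (countSubsets-⊆ neither? (W - u - v) ⊆W-u-v)) ⟩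
    2 ^ ∣ W ─ N[ u ] ∣ + (2 ^ ∣ W ─ N[ v ] ∣ + 2 ^ ∣ W - u - v ∣)
      ≤⟨ independenceBound-edge _ _ _ (lighter heavy-u) (lighter heavy-v) ⟩
    independenceBound (2 + ∣ W - u - v ∣)
      ≡⟨ cong independenceBound (sym ∣W∣≡2+∣W-u-v∣) ⟩
    independenceBound ∣ W ∣ ∎
    where
    open ≤-Reasoning
    neither? : Decidable (λ S → IndependentIn W S × u ∉ S × v ∉ S)
    neither? S = IndependentIn? W S ×-dec ¬? (u ∈? S) ×-dec ¬? (v ∈? S)
    split : ∀ S → IndependentIn W S × u ∉ S → (IndependentIn W S × v ∈ S) ⊎ (IndependentIn W S × u ∉ S × v ∉ S)
    split S (indep , u∉S) with v ∈? S
    ... | yes v∈S = inj₁ (indep , v∈S)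
    ... | no v∉S  = inj₂ (indep , u∉S , v∉S)
    ⊆W-u-v : ∀ S → IndependentIn W S × u ∉ S × v ∉ S → S ⊆ W - u - v
    ⊆W-u-v S ((S⊆W , _) , u∉S , v∉S) x∈S =
      x∈p∧x≢y⇒x∈p-y (x∈p∧x≢y⇒x∈p-y (S⊆W x∈S) λ { refl → u∉S x∈S }) λ { refl → v∉S x∈S }
    ∣W∣≡2+∣W-u-v∣ : ∣ W ∣ ≡ 2 + ∣ W - u - v ∣
    ∣W∣≡2+∣W-u-v∣ = trans (x∈p⇒∣p∣≡1+∣p-x∣ u∈W)
                          (cong suc (x∈p⇒∣p∣≡1+∣p-x∣ (x∈p∧x≢y⇒x∈p-y v∈W (Adj⇒≢ u~v ∘ sym))))
    lighter : ∀ {w} → Heavy W w → ∣ W ─ N[ w ] ∣ < ∣ W - u - v ∣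
    lighter {w} heavy = +-cancelˡ-≤ 2 _ _ (begin
      3 + ∣ W ─ N[ w ] ∣                ≤⟨ +-monoˡ-≤ _ heavy ⟩
      closedDegree W w + ∣ W ─ N[ w ] ∣ ≡⟨ +-comm (closedDegree W w) _ ⟩
      ∣ W ─ N[ w ] ∣ + closedDegree W w ≡⟨ ∣p─q∣+∣p∩q∣≡∣p∣ W N[ w ] ⟩
      ∣ W ∣                             ≡⟨ ∣W∣≡2+∣W-u-v∣ ⟩
      2 + ∣ W - u - v ∣                 ∎)

  ∃-leafStar : ∀ {W} → NoIsolatedIn W → Nonempty W → ¬ HeavyEdge W →
               ∃ λ c → c ∈ W × (∃ λ ℓ → ℓ ∈ W × Adj c ℓ) × (∀ {z} → z ∈ W → Adj c z → ¬ Heavy W z)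
  ∃-leafStar {W} noIso (x , x∈W) no-heavy with edgeToLight
    where
    edgeToLight : ∃ λ c → ∃ λ ℓ → c ∈ W × ℓ ∈ W × Adj c ℓ × ¬ Heavy W ℓ
    edgeToLight with noIso x x∈W
    ... | y , y∈W , x~y with 3 ≤? closedDegree W x | 3 ≤? closedDegree W y
    ...   | no light-x  | _           = y , x , y∈W , x∈W , Adj-sym x~y , light-x
    ...   | yes _       | no light-y  = x , y , x∈W , y∈W , x~y , light-y
    ...   | yes heavy-x | yes heavy-y = ⊥-elim (no-heavy (x , y , x∈W , y∈W , x~y , heavy-x , heavy-y))
  ... | c , ℓ , c∈W , ℓ∈W , c~ℓ , light-ℓ = c , c∈W , (ℓ , ℓ∈W , c~ℓ) , all-light
    where
    all-light : ∀ {z} → z ∈ W → Adj c z → ¬ Heavy W z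
    all-light {z} z∈W c~z heavy-z with 3 ≤? closedDegree W c
    ... | yes heavy-c = no-heavy (c , z , c∈W , z∈W , c~z , heavy-c , heavy-z)
    ... | no light-c with leaf-unique c∈W light-c ℓ∈W c~ℓ z∈W c~z
    ...   | refl = light-ℓ heavy-z

  CountIndependent≤ : Subset n → Set
  CountIndependent≤ W = NoIsolatedIn W → countSubsets (IndependentIn? W) ≤ independenceBound ∣ W ∣

  countIndependent-star : ∀ {W c ℓ} → c ∈ W → ℓ ∈ W → Adj c ℓ → (∀ {z} → z ∈ W → Adj c z → ¬ Heavy W z) →
                          (∀ W′ → ∣ W′ ∣ < ∣ W ∣ → CountIndependent≤ W′) → CountIndependent≤ W
  countIndependent-star {W} {c} {ℓ} c∈W ℓ∈W c~ℓ leaves ih noIso = begin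
    countSubsets (IndependentIn? W)
      ≤⟨ countIndependent-split W c ⟩
    countSubsets (Containing? W c) + countSubsets (Avoiding? W c)
      ≤⟨ +-mono-≤ (countSubsets-remove _ (IndependentIn? W′) c (λ _ → proj₂)
                                       (λ _ (indep , c∈S) → independentIn-remove indep c∈S))
                  (countSubsets-fibre _ (IndependentIn? W′) X avoiding-c) ⟩
    countSubsets (IndependentIn? W′) + 2 ^ ∣ X ∣ * countSubsets (IndependentIn? W′)
      ≤⟨ +-mono-≤ ih′ (*-monoʳ-≤ (2 ^ ∣ X ∣) ih′) ⟩
    independenceBound ∣ W′ ∣ + 2 ^ ∣ X ∣ * independenceBound ∣ W′ ∣
      ≤⟨ independenceBound-star ∣ W′ ∣ ∣ X ∣ (x∈p⇒1≤∣p∣ ℓ∈X) ⟩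
    independenceBound (∣ W′ ∣ + suc ∣ X ∣)
      ≡⟨ cong independenceBound ∣W′∣+1+∣X∣≡∣W∣ ⟩
    independenceBound ∣ W ∣ ∎
    where
    open ≤-Reasoning
    W′ X : Subset n
    W′ = W ─ N[ c ]
    X  = (W ∩ N[ c ]) - c

    ℓ∈X : ℓ ∈ X
    ℓ∈X = x∈p∧x≢y⇒x∈p-y (x∈p∩q⁺ (ℓ∈W , Adj⇒∈N c~ℓ)) (Adj⇒≢ c~ℓ ∘ sym)

    ∣W′∣+1+∣X∣≡∣W∣ : ∣ W′ ∣ + suc ∣ X ∣ ≡ ∣ W ∣
    ∣W′∣+1+∣X∣≡∣W∣ = trans (cong (∣ W′ ∣ +_) (sym (x∈p⇒∣p∣≡1+∣p-x∣ (x∈p∩q⁺ (c∈W , u∈N[u] c)))))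
                           (∣p─q∣+∣p∩q∣≡∣p∣ W N[ c ])

    noIso′ : NoIsolatedIn W′
    noIso′ x x∈W′ with x∈p─q⁻ W N[ c ] x∈W′
    ... | x∈W , x∉N[c] with noIso x x∈W
    ...   | y , y∈W , x~y = y , x∈p∧x∉q⇒x∈p─q y∈W y∉N[c] , x~y
      where
      y∉N[c] : y ∉ N[ c ]
      y∉N[c] y∈N[c] with ∈N⁻ y∈N[c]
      ... | inj₁ refl = x∉N[c] (Adj⇒∈N (Adj-sym x~y))
      ... | inj₂ c~y with leaf-unique y∈W (leaves y∈W c~y) c∈W (Adj-sym c~y) x∈W (Adj-sym x~y)
      ...   | refl = x∉N[c] (u∈N[u] c)

    ih′ : countSubsets (IndependentIn? W′) ≤ independenceBound ∣ W′ ∣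
    ih′ = ih W′ (subst (∣ W′ ∣ <_) ∣W′∣+1+∣X∣≡∣W∣ (m<m+n ∣ W′ ∣ (s≤s z≤n))) noIso′

    avoiding-c : ∀ S → IndependentIn W S × c ∉ S → IndependentIn W′ (S ─ X)
    avoiding-c S ((S⊆W , indep) , c∉S) =
      S─X⊆W′ , λ x y x∈ y∈ → indep x y (p─q⊆p S X x∈) (p─q⊆p S X y∈)
      where
      S─X⊆W′ : S ─ X ⊆ W′
      S─X⊆W′ {x} x∈S─X with x∈p─q⁻ S X x∈S─X
      ... | x∈S , x∉X = x∈p∧x∉q⇒x∈p─q (S⊆W x∈S) λ x∈N[c] → case ∈N⁻ x∈N[c] of λ where
        (inj₁ refl) → c∉S x∈S
        (inj₂ c~x)  → x∉X (x∈p∧x≢y⇒x∈p-y (x∈p∩q⁺ (S⊆W x∈S , x∈N[c])) (Adj⇒≢ c~x ∘ sym))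

  countIndependent≤independenceBound : ∀ fuel W → ∣ W ∣ ≤ fuel → CountIndependent≤ W
  countIndependent≤independenceBound fuel W _ _ with nonempty? W
  ... | no W=∅ = ≤-trans (countSubsets-⊆-empty _ W W=∅ (λ _ → proj₁)) (1≤independenceBound ∣ W ∣)
  countIndependent≤independenceBound zero W ∣W∣≤0 _ | yes (x , x∈W) =
    ⊥-elim (1+n≰n (≤-trans (x∈p⇒1≤∣p∣ x∈W) ∣W∣≤0))
  countIndependent≤independenceBound (suc fuel) W ∣W∣≤1+fuel noIso | yes W≠∅ with HeavyEdge? W
  ... | yes (u , v , u∈W , v∈W , u~v , heavy-u , heavy-v) =
    countIndependent-heavyEdge u∈W v∈W u~v heavy-u heavy-v
  ... | no no-heavy with ∃-leafStar noIso W≠∅ no-heavy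
  ...   | c , c∈W , (ℓ , ℓ∈W , c~ℓ) , leaves =
    countIndependent-star c∈W ℓ∈W c~ℓ leaves
      (λ W′ ∣W′∣<∣W∣ → countIndependent≤independenceBound fuel W′ (≤-pred (≤-trans ∣W′∣<∣W∣ ∣W∣≤1+fuel)))
      noIso

  NonIsolated : Fin n → Set
  NonIsolated x = ∃ λ y → Adj x y

  NonIsolated? : Decidable NonIsolated
  NonIsolated? x = any? (Adj? x)

  ∃-maximalIndependent : ∃ λ I → Independent I × Dominates full I
  ∃-maximalIndependent with ∃-maximal Independent? ∅ (λ x _ x∈∅ → ⊥-elim (∉⊥ x∈∅))
  ... | I , indep , maximal = I , indep , dominates
    where
    dominates : Dominates full I
    dominates x _ x∉I with any? (λ y → (y ∈? I) ×-dec Adj? x y)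
    ... | yes dominated = dominated
    ... | no undominated = ⊥-elim (maximal (I ∪ ⁅ x ⁆ , I⊂I∪⁅x⁆ , indep′))
      where
      I⊂I∪⁅x⁆ : I ⊂ I ∪ ⁅ x ⁆
      I⊂I∪⁅x⁆ = p⊆p∪q ⁅ x ⁆ , x , q⊆p∪q I ⁅ x ⁆ (x∈⁅x⁆ x) , x∉I
      ∈I∪⁅x⁆⁻ : ∀ {y} → y ∈ I ∪ ⁅ x ⁆ → y ∈ I ⊎ y ≡ x
      ∈I∪⁅x⁆⁻ y∈ = map₂ (x∈⁅y⁆⇒x≡y x) (x∈p∪q⁻ I ⁅ x ⁆ y∈)
      indep′ : Independent (I ∪ ⁅ x ⁆)
      indep′ a b a∈ b∈ a~b with ∈I∪⁅x⁆⁻ a∈ | ∈I∪⁅x⁆⁻ b∈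
      ... | inj₁ a∈I | inj₁ b∈I = indep a b a∈I b∈I a~b
      ... | inj₁ a∈I | inj₂ refl = undominated (a , a∈I , Adj-sym a~b)
      ... | inj₂ refl | inj₁ b∈I = undominated (b , b∈I , a~b)
      ... | inj₂ refl | inj₂ refl = Adj-irrefl a~b

  DominatesNonIsolated : Subset n → Set
  DominatesNonIsolated U = ∀ x → NonIsolated x → x ∉ U → ∃ λ u → u ∈ U × Adj x u

  ∃-smallDominatingSet : ∃ λ U → 2 * ∣ U ∣ ≤ n × DominatesNonIsolated U
  ∃-smallDominatingSet with ∃-maximalIndependent
  ... | I , indep , dom = smaller ∣V∩I∣+∣V─I∣≤n dominates-∩ dominates-─
    where
    V : Subset n
    V = ⟦ NonIsolated? ⟧
    ∣V∩I∣+∣V─I∣≤n : ∣ V ∩ I ∣ + ∣ V ─ I ∣ ≤ n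
    ∣V∩I∣+∣V─I∣≤n = subst (_≤ n) (trans (sym (∣p─q∣+∣p∩q∣≡∣p∣ V I)) (+-comm ∣ V ─ I ∣ _)) (∣p∣≤n V)
    smaller : ∀ {A B} → ∣ A ∣ + ∣ B ∣ ≤ n → DominatesNonIsolated A → DominatesNonIsolated B →
              ∃ λ U → 2 * ∣ U ∣ ≤ n × DominatesNonIsolated U
    smaller {A} {B} ∣A∣+∣B∣≤n dom-A dom-B with ∣ A ∣ ≤? ∣ B ∣
    ... | yes ∣A∣≤∣B∣ =
      A , ≤-trans (+-monoʳ-≤ ∣ A ∣ (≤-trans (≤-reflexive (+-identityʳ _)) ∣A∣≤∣B∣)) ∣A∣+∣B∣≤n , dom-A
    ... | no ∣A∣≰∣B∣ =
      B , ≤-trans (+-mono-≤ (<⇒≤ (≰⇒> ∣A∣≰∣B∣)) (≤-reflexive (+-identityʳ _))) ∣A∣+∣B∣≤n , dom-B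
    dominates-∩ : DominatesNonIsolated (V ∩ I)
    dominates-∩ x x-nonIso x∉ with x ∈? I
    ... | yes x∈I = ⊥-elim (x∉ (x∈p∩q⁺ (∈⟦⟧⁺ NonIsolated? x-nonIso , x∈I)))
    ... | no x∉I with dom x ∈⊤ x∉I
    ...   | y , y∈I , x~y = y , x∈p∩q⁺ (∈⟦⟧⁺ NonIsolated? (x , Adj-sym x~y) , y∈I) , x~y
    dominates-─ : DominatesNonIsolated (V ─ I)
    dominates-─ x (y , x~y) x∉ with x ∈? I
    ... | no x∉I = ⊥-elim (x∉ (x∈p∧x∉q⇒x∈p─q (∈⟦⟧⁺ NonIsolated? (y , x~y)) x∉I))
    ... | yes x∈I =
      y , x∈p∧x∉q⇒x∈p─q (∈⟦⟧⁺ NonIsolated? (x , Adj-sym x~y)) (λ y∈I → indep x y x∈I y∈I x~y) , x~y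

  countSubsets≤2^[n/2] : {P : Subset n → Set} (P? : Decidable P) →
    (∀ {S T x u} → P S → P T → Adj x u → (u ∈ S → u ∈ T) → (u ∈ T → u ∈ S) → x ∈ S → x ∈ T) →
    (∀ {S T x} → P S → P T → ¬ NonIsolated x → x ∈ S → x ∈ T) →
    countSubsets P? ≤ 2 ^ (n / 2)
  countSubsets≤2^[n/2] {P} P? via-neighbour isolated with ∃-smallDominatingSet
  ... | U , 2∣U∣≤n , dom = ≤-trans (countSubsets-determined P? U determined) (^-monoʳ-≤ 2 ∣U∣≤n/2)
    where
    ∣U∣≤n/2 : ∣ U ∣ ≤ n / 2
    ∣U∣≤n/2 = subst (_≤ n / 2) (m*n/n≡m ∣ U ∣ 2) (/-monoˡ-≤ 2 (subst (_≤ n) (*-comm 2 ∣ U ∣) 2∣U∣≤n))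
    agree : ∀ {S T x} → U ∩ S ≡ U ∩ T → x ∈ U → x ∈ S → x ∈ T
    agree {S} {T} eq x∈U x∈S = proj₂ (x∈p∩q⁻ U T (subst (_ ∈_) eq (x∈p∩q⁺ (x∈U , x∈S))))
    ⊆-from-trace : ∀ {S T} → P S → P T → U ∩ S ≡ U ∩ T → S ⊆ T
    ⊆-from-trace {S} {T} p q eq {x} x∈S with x ∈? U | NonIsolated? x
    ... | yes x∈U | _ = agree eq x∈U x∈S
    ... | no _ | no x-iso = isolated p q x-iso x∈S
    ... | no x∉U | yes x-nonIso with dom x x-nonIso x∉U
    ...   | u , u∈U , x~u = via-neighbour p q x~u (agree eq u∈U) (agree (sym eq) u∈U) x∈S
    determined : ∀ S T → P S → P T → U ∩ S ≡ U ∩ T → S ≡ T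
    determined S T p q eq = ⊆-antisym (⊆-from-trace p q eq) (⊆-from-trace q p (sym eq))

-- 2-uniform hypergraphs

-- The hypotheses are what is known about m = ∣ H ∩ (S ∪ T) ∣ for an edge H of size 2,
-- given a = ∣ H ∩ S ∣ and b = ∣ H ∩ T ∣.
UnionClosed : NatSet → Set
UnionClosed A = ∀ {a b m} → a ∈ᴸ A → b ∈ᴸ A → a ≤ m → b ≤ m → m ≤ 2 → (a ≡ 0 → b ≡ 0 → m ≡ 0) →
                m ∈ᴸ A

unionClosed-0 : UnionClosed (0 ∷ [])
unionClosed-0 (here refl) (here refl) _ _ _ zeros = here (zeros refl refl)

unionClosed-2 : UnionClosed (2 ∷ [])
unionClosed-2 (here refl) _ 2≤m _ m≤2 _ = here (≤-antisym m≤2 2≤m)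

unionClosed-12 : UnionClosed (1 ∷ 2 ∷ [])
unionClosed-12 {a} a∈ _ a≤m _ m≤2 _ = ∈[1,2] (≤-trans (1≤ a∈) a≤m) m≤2
  where
  1≤ : ∀ {a} → a ∈ᴸ (1 ∷ 2 ∷ []) → 1 ≤ a
  1≤ (here refl)         = s≤s z≤n
  1≤ (there (here refl)) = s≤s z≤n
  ∈[1,2] : ∀ {m} → 1 ≤ m → m ≤ 2 → m ∈ᴸ (1 ∷ 2 ∷ [])
  ∈[1,2] (s≤s z≤n) (s≤s z≤n)       = here refl
  ∈[1,2] (s≤s z≤n) (s≤s (s≤s z≤n)) = there (here refl)

unionClosed-02 : UnionClosed (0 ∷ 2 ∷ [])
unionClosed-02 (there (here refl)) _ 2≤m _ m≤2 _ = there (here (≤-antisym m≤2 2≤m))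
unionClosed-02 (here refl) (there (here refl)) _ 2≤m m≤2 _ = there (here (≤-antisym m≤2 2≤m))
unionClosed-02 (here refl) (here refl) _ _ _ zeros = here (zeros refl refl)

≤2⇒∈[0,1,2] : ∀ {m} → m ≤ 2 → m ∈ᴸ (0 ∷ 1 ∷ 2 ∷ [])
≤2⇒∈[0,1,2] z≤n             = here refl
≤2⇒∈[0,1,2] (s≤s z≤n)       = there (here refl)
≤2⇒∈[0,1,2] (s≤s (s≤s z≤n)) = there (there (here refl))

unionClosed-012 : UnionClosed (0 ∷ 1 ∷ 2 ∷ [])
unionClosed-012 _ _ _ _ m≤2 _ = ≤2⇒∈[0,1,2] m≤2

module TwoUniform {n : ℕ} (𝓗 : Hypergraph 2 n) where

  Edge : Subset n → Set
  Edge H = isEdge 𝓗 H ≡ true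

  Edge? : Decidable Edge
  Edge? H = isEdge 𝓗 H ≟ᵇ true

  Adj : Fin n → Fin n → Set
  Adj x y = ∃ λ H → Edge H × x ∈ H × y ∈ H × x ≢ y

  Adj? : ∀ x y → Dec (Adj x y)
  Adj? x y = anySubset? λ H → Edge? H ×-dec (x ∈? H) ×-dec (y ∈? H) ×-dec ¬? (x ≟ᶠ y)

  Adj-sym : ∀ {x y} → Adj x y → Adj y x
  Adj-sym (H , e , x∈H , y∈H , x≢y) = H , e , y∈H , x∈H , x≢y ∘ sym

  Adj-irrefl : ∀ {x} → ¬ Adj x x
  Adj-irrefl (_ , _ , _ , _ , x≢x) = x≢x refl

  open Graph Adj Adj? Adj-sym Adj-irrefl public

  ∈Edge⇒NonIsolated : ∀ {H x} → Edge H → x ∈ H → NonIsolated x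
  ∈Edge⇒NonIsolated {H} {x} e x∈H with 1≤∣p∣⇒Nonempty (H - x) (subst (1 ≤_) ∣H-x∣≡1 ≤-refl)
    where
    ∣H-x∣≡1 : 1 ≡ ∣ H - x ∣
    ∣H-x∣≡1 = suc-injective (trans (sym (uniform 𝓗 H e)) (x∈p⇒∣p∣≡1+∣p-x∣ x∈H))
  ... | y , y∈H-x with x∈p-y⁻ H y∈H-x
  ...   | y∈H , y≢x = y , H , e , x∈H , y∈H , y≢x ∘ sym

  NoIsolated⇒∈Edge : NoIsolated 𝓗 → ∀ x → ∃ λ H → Edge H × x ∈ H
  NoIsolated⇒∈Edge noIso x with anySubset? (λ H → Edge? H ×-dec (x ∈? H))
  ... | yes x∈edge = x∈edge
  ... | no  x∉edge = ⊥-elim (noIso x x∉edge)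

  NoIsolated⇒NonIsolated : NoIsolated 𝓗 → ∀ x → NonIsolated x
  NoIsolated⇒NonIsolated noIso x = let H , e , x∈H = NoIsolated⇒∈Edge noIso x in ∈Edge⇒NonIsolated e x∈H

  module _ {H : Subset n} {x u : Fin n} (e : Edge H) (x∈H : x ∈ H) (u∈H : u ∈ H) (x≢u : x ≢ u) where

    private
      ∣H∩S∣+∣H∩∁S∣≡2 : ∀ S → ∣ H ∩ S ∣ + ∣ H ∩ ∁ S ∣ ≡ 2
      ∣H∩S∣+∣H∩∁S∣≡2 S = trans (∣p∩q∣+∣p∩∁q∣≡∣p∣ H S) (uniform 𝓗 H e)

    ∣H∩S∣≡2 : ∀ {S} → x ∈ S → u ∈ S → ∣ H ∩ S ∣ ≡ 2
    ∣H∩S∣≡2 {S} x∈S u∈S = ≤-antisym (subst (∣ H ∩ S ∣ ≤_) (uniform 𝓗 H e) (∣p∩q∣≤∣p∣ H S))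
                                    (2≤∣p∣ (x∈p∩q⁺ (x∈H , x∈S)) (x∈p∩q⁺ (u∈H , u∈S)) x≢u)

    ∣H∩S∣≡0 : ∀ {S} → x ∉ S → u ∉ S → ∣ H ∩ S ∣ ≡ 0
    ∣H∩S∣≡0 {S} x∉S u∉S = +-cancelʳ-≡ ∣ H ∩ ∁ S ∣ ∣ H ∩ S ∣ 0
      (trans (∣H∩S∣+∣H∩∁S∣≡2 S) (sym (∣H∩S∣≡2 (x∉p⇒x∈∁p x∉S) (x∉p⇒x∈∁p u∉S))))

    ∣H∩S∣≡1 : ∀ {S} → x ∈ S → u ∉ S → ∣ H ∩ S ∣ ≡ 1
    ∣H∩S∣≡1 {S} x∈S u∉S = ≤-antisym ∣H∩S∣≤1 (x∈p⇒1≤∣p∣ (x∈p∩q⁺ (x∈H , x∈S)))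
      where
      ∣H∩S∣≤1 : ∣ H ∩ S ∣ ≤ 1
      ∣H∩S∣≤1 = +-cancelʳ-≤ 1 _ _ (≤-trans (+-monoʳ-≤ ∣ H ∩ S ∣ (x∈p⇒1≤∣p∣ (x∈p∩q⁺ (u∈H , x∉p⇒x∈∁p u∉S))))
                                            (≤-reflexive (∣H∩S∣+∣H∩∁S∣≡2 S)))

  ∃-violatedEdge : ∀ {A S} → ¬ IsTransversal A 𝓗 S → ∃ λ H → Edge H × ¬ (∣ H ∩ S ∣ ∈ᴸ A)
  ∃-violatedEdge {A} {S} ¬transversal with anySubset? (λ H → Edge? H ×-dec ¬? (∣ H ∩ S ∣ ∈ᴸ? A))
  ... | yes violated = violated
  ... | no none-violated =
    ⊥-elim (¬transversal λ H e → decidable-stable (∣ H ∩ S ∣ ∈ᴸ? A) λ ∉A → none-violated (H , e , ∉A))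

  maximal-¬extend : ∀ {A S w} → IsMaximalTransversal A 𝓗 S → w ∉ S → ¬ IsTransversal A 𝓗 (S ∪ ⁅ w ⁆)
  maximal-¬extend {S = S} {w} (_ , maximal) w∉S transversal =
    maximal (S ∪ ⁅ w ⁆ , (p⊆p∪q ⁅ w ⁆ , w , q⊆p∪q S ⁅ w ⁆ (x∈⁅x⁆ w) , w∉S) , transversal)

  maximal-∋-isolated : ∀ {A S x} → IsMaximalTransversal A 𝓗 S → ¬ NonIsolated x → x ∈ S
  maximal-∋-isolated {A} {S} {x} maximal x-iso with x ∈? S
  ... | yes x∈S = x∈S
  ... | no x∉S = ⊥-elim (maximal-¬extend maximal x∉S λ H e →
    subst (_∈ᴸ A) (cong ∣_∣ (sym (w∉p⇒p∩[q∪⁅w⁆]≡p∩q (x-iso ∘ ∈Edge⇒NonIsolated e)))) (proj₁ maximal H e))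

  -- When 0 ∈ A forces 1 ∈ A, adding a vertex without neighbours in S cannot break an edge.
  maximal-dominates : ∀ {A S} → (0 ∈ᴸ A → 1 ∈ᴸ A) → IsMaximalTransversal A 𝓗 S → Dominates full S
  maximal-dominates {A} {S} 0⇒1 maximal w _ w∉S with ∃-violatedEdge (maximal-¬extend maximal w∉S)
  ... | H , e , violated with w ∈? H
  ...   | no w∉H =
    ⊥-elim (violated (subst (_∈ᴸ A) (cong ∣_∣ (sym (w∉p⇒p∩[q∪⁅w⁆]≡p∩q w∉H))) (proj₁ maximal H e)))
  ...   | yes w∈H with nonempty? (H ∩ S)
  ...     | yes (y , y∈H∩S) = let y∈H , y∈S = x∈p∩q⁻ H S y∈H∩S in
                              y , y∈S , H , e , w∈H , y∈H , λ { refl → w∉S y∈S }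
  ...     | no H∩S=∅ = ⊥-elim (violated (≤1∈A (≤-trans (p⊆q⇒∣p∣≤∣q∣ ⊆⁅w⁆) (≤-reflexive (∣⁅x⁆∣≡1 w)))))
    where
    0∈A : 0 ∈ᴸ A
    0∈A = subst (_∈ᴸ A) (Empty⇒∣p∣≡0 H∩S=∅) (proj₁ maximal H e)
    ≤1∈A : ∀ {m} → m ≤ 1 → m ∈ᴸ A
    ≤1∈A z≤n = 0∈A
    ≤1∈A (s≤s z≤n) = 0⇒1 0∈A
    ⊆⁅w⁆ : H ∩ (S ∪ ⁅ w ⁆) ⊆ ⁅ w ⁆
    ⊆⁅w⁆ x∈ with x∈p∩q⁻ H (S ∪ ⁅ w ⁆) x∈
    ... | x∈H , x∈S∪⁅w⁆ with x∈p∪q⁻ S ⁅ w ⁆ x∈S∪⁅w⁆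
    ...   | inj₁ x∈S = ⊥-elim (H∩S=∅ (_ , x∈p∩q⁺ (x∈H , x∈S)))
    ...   | inj₂ x∈⁅w⁆ = x∈⁅w⁆

  transversal01⇒independent : ∀ {S} → IsTransversal (0 ∷ 1 ∷ []) 𝓗 S → Independent S
  transversal01⇒independent {S} transversal x y x∈S y∈S (H , e , x∈H , y∈H , x≢y) =
    from-no (2 ∈ᴸ? (0 ∷ 1 ∷ [])) (subst (_∈ᴸ _) (∣H∩S∣≡2 e x∈H y∈H x≢y x∈S y∈S) (transversal H e))

  numMaximalTransversals01≤moonMoser : numMaximalTransversals (0 ∷ 1 ∷ []) 𝓗 ≤ moonMoser n
  numMaximalTransversals01≤moonMoser = begin
    numMaximalTransversals (0 ∷ 1 ∷ []) 𝓗
      ≤⟨ countSubsets-mono _ (MaximalIndependentIn? full)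
           (λ S maximal → (⊆⊤ , transversal01⇒independent (proj₁ maximal)) ,
                          maximal-dominates (λ _ → there (here refl)) maximal) ⟩
    countSubsets (MaximalIndependentIn? full)
      ≤⟨ countMaximalIndependent≤moonMoser n full (≤-reflexive (∣⊤∣≡n n)) ⟩
    moonMoser ∣ full {n} ∣
      ≡⟨ cong moonMoser (∣⊤∣≡n n) ⟩
    moonMoser n ∎
    where open ≤-Reasoning

  numTransversals01≤independenceBound : NoIsolated 𝓗 → numTransversals (0 ∷ 1 ∷ []) 𝓗 ≤ independenceBound n
  numTransversals01≤independenceBound noIso = begin
    numTransversals (0 ∷ 1 ∷ []) 𝓗
      ≤⟨ countSubsets-mono _ (IndependentIn? full) (λ S transversal → ⊆⊤ , transversal01⇒independent transversal) ⟩
    countSubsets (IndependentIn? full)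
      ≤⟨ countIndependent≤independenceBound n full (≤-reflexive (∣⊤∣≡n n)) noIso′ ⟩
    independenceBound ∣ full {n} ∣
      ≡⟨ cong independenceBound (∣⊤∣≡n n) ⟩
    independenceBound n ∎
    where
    open ≤-Reasoning
    noIso′ : NoIsolatedIn full
    noIso′ x _ = let y , x~y = NoIsolated⇒NonIsolated noIso x in y , ∈⊤ , x~y

  numTransversals-∁ : ∀ {A B} → (∀ {m} → m ∈ᴸ A → 2 ∸ m ∈ᴸ B) → numTransversals A 𝓗 ≤ numTransversals B 𝓗
  numTransversals-∁ {A} {B} 2∸A⊆B = countSubsets-∁ _ (isTransversal? B 𝓗) λ S transversal H e →
    subst (_∈ᴸ B) (2∸∣H∩S∣≡∣H∩∁S∣ H e) (2∸A⊆B (transversal H e))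
    where
    2∸∣H∩S∣≡∣H∩∁S∣ : ∀ {S} H → Edge H → 2 ∸ ∣ H ∩ S ∣ ≡ ∣ H ∩ ∁ S ∣
    2∸∣H∩S∣≡∣H∩∁S∣ {S} H e =
      trans (cong (_∸ ∣ H ∩ S ∣) (sym (trans (∣p∩q∣+∣p∩∁q∣≡∣p∣ H S) (uniform 𝓗 H e)))) (m+n∸m≡n ∣ H ∩ S ∣ _)

  numTransversals12≤independenceBound : NoIsolated 𝓗 → numTransversals (1 ∷ 2 ∷ []) 𝓗 ≤ independenceBound n
  numTransversals12≤independenceBound noIso =
    ≤-trans (numTransversals-∁ λ { (here refl) → there (here refl) ; (there (here refl)) → here refl })
            (numTransversals01≤independenceBound noIso)

  numTransversals0≤1 : NoIsolated 𝓗 → numTransversals (0 ∷ []) 𝓗 ≤ 1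
  numTransversals0≤1 noIso = countSubsets-⊆-empty _ ∅ (λ (_ , x∈∅) → ∉⊥ x∈∅) ⊆∅
    where
    ⊆∅ : ∀ S → IsTransversal (0 ∷ []) 𝓗 S → S ⊆ ∅
    ⊆∅ S transversal {x} x∈S with NoIsolated⇒∈Edge noIso x
    ... | H , e , x∈H with transversal H e
    ...   | here ∣H∩S∣≡0 = ⊥-elim (1+n≰n (subst (1 ≤_) ∣H∩S∣≡0 (x∈p⇒1≤∣p∣ (x∈p∩q⁺ (x∈H , x∈S)))))

  numTransversals2≤1 : NoIsolated 𝓗 → numTransversals (2 ∷ []) 𝓗 ≤ 1
  numTransversals2≤1 noIso = countSubsets≤1 _ λ S T s t → trans (≡full S s) (sym (≡full T t))
    where
    ≡full : ∀ S → IsTransversal (2 ∷ []) 𝓗 S → S ≡ full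
    ≡full S transversal = ⊆-antisym ⊆⊤ λ {x} _ → case NoIsolated⇒∈Edge noIso x of λ where
      (H , e , x∈H) → case transversal H e of λ where
        (here ∣H∩S∣≡2) → ∣p∩q∣≡∣p∣⇒p⊆q H S (trans ∣H∩S∣≡2 (sym (uniform 𝓗 H e))) x∈H

  via-neighbour-1 : ∀ {S T x u} → IsTransversal (1 ∷ []) 𝓗 S → IsTransversal (1 ∷ []) 𝓗 T → Adj x u →
                    (u ∈ S → u ∈ T) → (u ∈ T → u ∈ S) → x ∈ S → x ∈ T
  via-neighbour-1 {S} {T} {x} {u} s t (H , e , x∈H , u∈H , x≢u) _ u∈T⇒u∈S x∈S with x ∈? T | u ∈? S
  ... | yes x∈T | _       = x∈T
  ... | no _    | yes u∈S =
    ⊥-elim (from-no (2 ∈ᴸ? (1 ∷ [])) (subst (_∈ᴸ _) (∣H∩S∣≡2 e x∈H u∈H x≢u x∈S u∈S) (s H e)))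
  ... | no x∉T  | no u∉S  =
    ⊥-elim (from-no (0 ∈ᴸ? (1 ∷ [])) (subst (_∈ᴸ _) (∣H∩S∣≡0 e x∈H u∈H x≢u x∉T (u∉S ∘ u∈T⇒u∈S)) (t H e)))

  via-neighbour-02 : ∀ {S T x u} → IsTransversal (0 ∷ 2 ∷ []) 𝓗 S → IsTransversal (0 ∷ 2 ∷ []) 𝓗 T → Adj x u →
                     (u ∈ S → u ∈ T) → (u ∈ T → u ∈ S) → x ∈ S → x ∈ T
  via-neighbour-02 {S} {T} {x} {u} s t (H , e , x∈H , u∈H , x≢u) u∈S⇒u∈T _ x∈S with x ∈? T | u ∈? S
  ... | yes x∈T | _       = x∈T
  ... | no _    | no u∉S  =
    ⊥-elim (from-no (1 ∈ᴸ? (0 ∷ 2 ∷ [])) (subst (_∈ᴸ _) (∣H∩S∣≡1 e x∈H u∈H x≢u x∈S u∉S) (s H e)))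
  ... | no x∉T  | yes u∈S =
    ⊥-elim (from-no (1 ∈ᴸ? (0 ∷ 2 ∷ []))
                    (subst (_∈ᴸ _) (∣H∩S∣≡1 e u∈H x∈H (x≢u ∘ sym) (u∈S⇒u∈T u∈S) x∉T) (t H e)))

  numTransversals1≤2^[n/2] : NoIsolated 𝓗 → numTransversals (1 ∷ []) 𝓗 ≤ 2 ^ (n / 2)
  numTransversals1≤2^[n/2] noIso =
    countSubsets≤2^[n/2] _ via-neighbour-1 λ _ _ x-iso → ⊥-elim (x-iso (NoIsolated⇒NonIsolated noIso _))

  numTransversals02≤2^[n/2] : NoIsolated 𝓗 → numTransversals (0 ∷ 2 ∷ []) 𝓗 ≤ 2 ^ (n / 2)
  numTransversals02≤2^[n/2] noIso =
    countSubsets≤2^[n/2] _ via-neighbour-02 λ _ _ x-iso → ⊥-elim (x-iso (NoIsolated⇒NonIsolated noIso _))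

  numMaximalTransversals1≤2^[n/2] : numMaximalTransversals (1 ∷ []) 𝓗 ≤ 2 ^ (n / 2)
  numMaximalTransversals1≤2^[n/2] =
    countSubsets≤2^[n/2] _ (λ s t → via-neighbour-1 (proj₁ s) (proj₁ t))
                           (λ _ t x-iso _ → maximal-∋-isolated t x-iso)

  ∪-transversal : ∀ {A S T} → UnionClosed A →
                  IsTransversal A 𝓗 S → IsTransversal A 𝓗 T → IsTransversal A 𝓗 (S ∪ T)
  ∪-transversal {A} {S} {T} closed s t H e =
    closed (s H e) (t H e) (p⊆q⇒∣p∣≤∣q∣ (∩-monoʳ (p⊆p∪q T))) (p⊆q⇒∣p∣≤∣q∣ (∩-monoʳ (q⊆p∪q S T)))
           (subst (∣ H ∩ (S ∪ T) ∣ ≤_) (uniform 𝓗 H e) (∣p∩q∣≤∣p∣ H (S ∪ T))) zeros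
    where
    ∩-monoʳ : ∀ {X Y} → X ⊆ Y → H ∩ X ⊆ H ∩ Y
    ∩-monoʳ {X} X⊆Y x∈ = let x∈H , x∈X = x∈p∩q⁻ H X x∈ in x∈p∩q⁺ (x∈H , X⊆Y x∈X)
    zeros : ∣ H ∩ S ∣ ≡ 0 → ∣ H ∩ T ∣ ≡ 0 → ∣ H ∩ (S ∪ T) ∣ ≡ 0
    zeros ∣H∩S∣≡0 ∣H∩T∣≡0 = Empty⇒∣p∣≡0 λ (x , x∈) → case x∈p∩q⁻ H (S ∪ T) x∈ of λ where
      (x∈H , x∈S∪T) → case x∈p∪q⁻ S T x∈S∪T of λ where
        (inj₁ x∈S) → 1+n≰n (subst (1 ≤_) ∣H∩S∣≡0 (x∈p⇒1≤∣p∣ (x∈p∩q⁺ (x∈H , x∈S))))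
        (inj₂ x∈T) → 1+n≰n (subst (1 ≤_) ∣H∩T∣≡0 (x∈p⇒1≤∣p∣ (x∈p∩q⁺ (x∈H , x∈T))))

  numMaximalTransversals≤1 : ∀ {A} → UnionClosed A → numMaximalTransversals A 𝓗 ≤ 1
  numMaximalTransversals≤1 {A} closed =
    countSubsets≤1 _ λ S T s t → ⊆-antisym (⊆-maximal t s) (⊆-maximal s t)
    where
    ⊆-maximal : ∀ {S T} → IsMaximalTransversal A 𝓗 S → IsMaximalTransversal A 𝓗 T → T ⊆ S
    ⊆-maximal {S} {T} (s , S-maximal) (t , _) {x} x∈T with x ∈? S
    ... | yes x∈S = x∈S
    ... | no x∉S =
      ⊥-elim (S-maximal (S ∪ T , (p⊆p∪q T , x , q⊆p∪q S T x∈T , x∉S) , ∪-transversal closed s t))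

  transversal∧dominates⇒maximal : ∀ {A S} → (∀ {m} → m ∈ᴸ A → m ≤ 1) →
                                  IsTransversal A 𝓗 S → Dominates full S → IsMaximalTransversal A 𝓗 S
  transversal∧dominates⇒maximal {A} {S} A≤1 transversal dominates = transversal , not-extendable
    where
    not-extendable : ¬ (∃ λ T → S ⊂ T × IsTransversal A 𝓗 T)
    not-extendable (T , (S⊆T , x , x∈T , x∉S) , T-transversal) with dominates x ∈⊤ x∉S
    ... | y , y∈S , (H , e , x∈H , y∈H , x≢y) =
      1+n≰n (≤-trans (2≤∣p∣ (x∈p∩q⁺ (x∈H , x∈T)) (x∈p∩q⁺ (y∈H , S⊆T y∈S)) x≢y) (A≤1 (T-transversal H e)))

-- Constructions

does-true⇒ : ∀ {A : Set} (a? : Dec A) → does a? ≡ true → A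
does-true⇒ (yes a) _ = a

edgeless : ∀ n → Hypergraph 2 n
edgeless n = record { isEdge = λ _ → false ; uniform = λ _ () }

complete : ∀ n → Hypergraph 2 n
complete n = record { isEdge = λ H → does (∣ H ∣ ≟ 2) ; uniform = λ H → does-true⇒ (∣ H ∣ ≟ 2) }

path3 : Hypergraph 2 3
path3 = record { isEdge = isEdge′ ; uniform = uniform′ }
  where
  isEdge′ : Subset 3 → Bool
  isEdge′ H@(_ ∷ middle ∷ _ ∷ []) = middle ∧ does (∣ H ∣ ≟ 2)
  uniform′ : ∀ H → isEdge′ H ≡ true → ∣ H ∣ ≡ 2
  uniform′ H@(_ ∷ inside ∷ _ ∷ []) = does-true⇒ (∣ H ∣ ≟ 2)

star : ∀ n → Hypergraph 2 (suc n)
star n = record { isEdge = isEdge′ ; uniform = uniform′ }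
  where
  isEdge′ : Subset (suc n) → Bool
  isEdge′ (centre ∷ H) = centre ∧ does (∣ H ∣ ≟ 1)
  uniform′ : ∀ H → isEdge′ H ≡ true → ∣ H ∣ ≡ 2
  uniform′ (inside ∷ H) = cong suc ∘ does-true⇒ (∣ H ∣ ≟ 1)

edgeless-maximal : ∀ A n → 1 ≤ numMaximalTransversals A (edgeless n)
edgeless-maximal A n =
  countSubsets-witness (isMaximalTransversal? A (edgeless n)) full
    ((λ _ ()) , λ (_ , (_ , _ , _ , x∉full) , _) → x∉full ∈⊤)

spoke : ∀ (w : Fin n) → isEdge (star n) (inside ∷ ⁅ w ⁆) ≡ true
spoke w = dec-true (∣ ⁅ w ⁆ ∣ ≟ 1) (∣⁅x⁆∣≡1 w)

star-noIsolated : ∀ n → NoIsolated (star (suc n))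
star-noIsolated n zero    isolated = isolated (inside ∷ ⁅ zero ⁆ , spoke {suc n} zero , here)
star-noIsolated n (suc w) isolated = isolated (inside ∷ ⁅ w ⁆ , spoke w , there (x∈⁅x⁆ w))

star-transversals01 : ∀ n → 1 + 2 ^ n ≤ numTransversals (0 ∷ 1 ∷ []) (star n)
star-transversals01 n =
  +-mono-≤ (countSubsets-witness (isTransversal? _ _ ∘ (inside ∷_)) ∅ centre-only)
           (countSubsets-universal (isTransversal? _ _ ∘ (outside ∷_)) leaves-only)
  where
  centre-only : IsTransversal (0 ∷ 1 ∷ []) (star n) (inside ∷ ∅)
  centre-only (inside ∷ H) _ = there (here (cong suc (∣p∩⊥∣≡0 H)))
  leaves-only : ∀ T → IsTransversal (0 ∷ 1 ∷ []) (star n) (outside ∷ T)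
  leaves-only T (inside ∷ H) e
    with ∣ H ∩ T ∣ | ≤-trans (∣p∩q∣≤∣p∣ H T) (≤-reflexive (does-true⇒ (∣ H ∣ ≟ 1) e))
  ... | 0 | _ = here refl
  ... | 1 | _ = there (here refl)
  ... | suc (suc _) | s≤s ()

take-++ : (a : Subset k) (b : Subset m) → take k (a ++ b) ≡ a
take-++ []      b = refl
take-++ (s ∷ a) b = cong (s ∷_) (take-++ a b)

drop-++ : (a : Subset k) (b : Subset m) → drop k (a ++ b) ≡ b
drop-++ []      b = refl
drop-++ (s ∷ a) b = drop-++ a b

∣p++q∣≡∣p∣+∣q∣ : (p : Subset k) (q : Subset m) → ∣ p ++ q ∣ ≡ ∣ p ∣ + ∣ q ∣
∣p++q∣≡∣p∣+∣q∣ []            q = refl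
∣p++q∣≡∣p∣+∣q∣ (inside ∷ p)  q = cong suc (∣p++q∣≡∣p∣+∣q∣ p q)
∣p++q∣≡∣p∣+∣q∣ (outside ∷ p) q = ∣p++q∣≡∣p∣+∣q∣ p q

↑ˡ∈++⁺ : ∀ {i} {p : Subset k} (q : Subset m) → i ∈ p → i ↑ˡ m ∈ p ++ q
↑ˡ∈++⁺ q here        = here
↑ˡ∈++⁺ q (there i∈p) = there (↑ˡ∈++⁺ q i∈p)

↑ʳ∈++⁺ : ∀ {j} (p : Subset k) {q : Subset m} → j ∈ q → k ↑ʳ j ∈ p ++ q
↑ʳ∈++⁺ []      j∈q = j∈q
↑ʳ∈++⁺ (_ ∷ p) j∈q = there (↑ʳ∈++⁺ p j∈q)

++-view : ∀ {k m} (x : Fin (k + m)) → (∃ λ i → x ≡ i ↑ˡ m) ⊎ (∃ λ j → x ≡ k ↑ʳ j)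
++-view {k} x with splitAt k x in eq
... | inj₁ i = inj₁ (i , sym (splitAt⁻¹-↑ˡ eq))
... | inj₂ j = inj₂ (j , sym (splitAt⁻¹-↑ʳ eq))

⊕-isEdge : Hypergraph 2 k → Hypergraph 2 m → Subset k → Subset m → Bool
⊕-isEdge 𝓗₁ 𝓗₂ a b = (isEdge 𝓗₁ a ∧ does (b ≟ˢ ∅)) ∨ (does (a ≟ˢ ∅) ∧ isEdge 𝓗₂ b)

⊕-isEdge⁻ : (𝓗₁ : Hypergraph 2 k) (𝓗₂ : Hypergraph 2 m) (a : Subset k) (b : Subset m) →
            ⊕-isEdge 𝓗₁ 𝓗₂ a b ≡ true → (isEdge 𝓗₁ a ≡ true × b ≡ ∅) ⊎ (a ≡ ∅ × isEdge 𝓗₂ b ≡ true)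
⊕-isEdge⁻ 𝓗₁ 𝓗₂ a b e with isEdge 𝓗₁ a | b ≟ˢ ∅ | a ≟ˢ ∅ | isEdge 𝓗₂ b
... | true  | yes b≡∅ | _       | _     = inj₁ (refl , b≡∅)
... | true  | no _    | yes a≡∅ | true  = inj₂ (a≡∅ , refl)
... | false | _       | yes a≡∅ | true  = inj₂ (a≡∅ , refl)
... | true  | no _    | no _    | _     with () ← e
... | true  | no _    | yes _   | false with () ← e
... | false | _       | no _    | _     with () ← e
... | false | _       | yes _   | false with () ← e

_⊕_ : Hypergraph 2 k → Hypergraph 2 m → Hypergraph 2 (k + m)
_⊕_ {k} {m} 𝓗₁ 𝓗₂ = record { isEdge = λ H → ⊕-isEdge 𝓗₁ 𝓗₂ (take k H) (drop k H) ; uniform = uniform′ }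
  where
  uniform′ : ∀ H → ⊕-isEdge 𝓗₁ 𝓗₂ (take k H) (drop k H) ≡ true → ∣ H ∣ ≡ 2
  uniform′ H e = trans (cong ∣_∣ (sym (take++drop≡id k H)))
                       (trans (∣p++q∣≡∣p∣+∣q∣ a b) (by-parts (⊕-isEdge⁻ 𝓗₁ 𝓗₂ a b e)))
    where
    a = take k H
    b = drop k H
    by-parts : (isEdge 𝓗₁ a ≡ true × b ≡ ∅) ⊎ (a ≡ ∅ × isEdge 𝓗₂ b ≡ true) → ∣ a ∣ + ∣ b ∣ ≡ 2
    by-parts (inj₁ (e₁ , b≡∅)) = cong₂ _+_ (uniform 𝓗₁ a e₁) (trans (cong ∣_∣ b≡∅) (∣⊥∣≡0 m))
    by-parts (inj₂ (a≡∅ , e₂)) = cong₂ _+_ (trans (cong ∣_∣ a≡∅) (∣⊥∣≡0 k)) (uniform 𝓗₂ b e₂)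

module _ (𝓗₁ : Hypergraph 2 k) (𝓗₂ : Hypergraph 2 m) where

  private
    module U₁ = TwoUniform 𝓗₁
    module U₂ = TwoUniform 𝓗₂
    module U = TwoUniform (𝓗₁ ⊕ 𝓗₂)

  ⊕-edge : ∀ a b → isEdge (𝓗₁ ⊕ 𝓗₂) (a ++ b) ≡ ⊕-isEdge 𝓗₁ 𝓗₂ a b
  ⊕-edge a b = cong₂ (⊕-isEdge 𝓗₁ 𝓗₂) (take-++ a b) (drop-++ a b)

  ⊕-edgeˡ : ∀ {a} → isEdge 𝓗₁ a ≡ true → isEdge (𝓗₁ ⊕ 𝓗₂) (a ++ ∅) ≡ true
  ⊕-edgeˡ {a} e₁ rewrite ⊕-edge a (∅ {m}) | e₁ | dec-true (∅ {m} ≟ˢ ∅) refl = refl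

  ⊕-edgeʳ : ∀ {b} → isEdge 𝓗₂ b ≡ true → isEdge (𝓗₁ ⊕ 𝓗₂) (∅ {k} ++ b) ≡ true
  ⊕-edgeʳ {b} e₂ rewrite ⊕-edge (∅ {k}) b | e₂ | dec-true (∅ {k} ≟ˢ ∅) refl =
    ∨-zeroʳ (isEdge 𝓗₁ ∅ ∧ does (b ≟ˢ ∅))

  ⊕-noIsolated : NoIsolated 𝓗₁ → NoIsolated 𝓗₂ → NoIsolated (𝓗₁ ⊕ 𝓗₂)
  ⊕-noIsolated noIso₁ noIso₂ x isolated with ++-view {k} x
  ... | inj₁ (i , refl) = noIso₁ i λ (a , e , i∈a) → isolated (a ++ ∅ , ⊕-edgeˡ e , ↑ˡ∈++⁺ ∅ i∈a)
  ... | inj₂ (j , refl) = noIso₂ j λ (b , e , j∈b) → isolated (∅ {k} ++ b , ⊕-edgeʳ e , ↑ʳ∈++⁺ ∅ j∈b)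

  ⊕-transversal : ∀ {A S T} → IsTransversal A 𝓗₁ S → IsTransversal A 𝓗₂ T →
                  IsTransversal A (𝓗₁ ⊕ 𝓗₂) (S ++ T)
  ⊕-transversal {A} {S} {T} s t H e =
    subst (λ H → ∣ H ∩ (S ++ T) ∣ ∈ᴸ A) (take++drop≡id k H)
          (on-parts (take k H) (drop k H) (⊕-isEdge⁻ 𝓗₁ 𝓗₂ (take k H) (drop k H) e))
    where
    ∣[a++b]∩[S++T]∣ : ∀ a b → ∣ (a ++ b) ∩ (S ++ T) ∣ ≡ ∣ a ∩ S ∣ + ∣ b ∩ T ∣
    ∣[a++b]∩[S++T]∣ a b = trans (cong ∣_∣ (zipWith-++ _∧_ a b S T)) (∣p++q∣≡∣p∣+∣q∣ (a ∩ S) (b ∩ T))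
    on-parts : ∀ a b → (isEdge 𝓗₁ a ≡ true × b ≡ ∅) ⊎ (a ≡ ∅ × isEdge 𝓗₂ b ≡ true) →
               ∣ (a ++ b) ∩ (S ++ T) ∣ ∈ᴸ A
    on-parts a _ (inj₁ (e₁ , refl)) = subst (_∈ᴸ A) (sym (begin-equality
      ∣ (a ++ ∅) ∩ (S ++ T) ∣ ≡⟨ ∣[a++b]∩[S++T]∣ a ∅ ⟩
      ∣ a ∩ S ∣ + ∣ ∅ ∩ T ∣   ≡⟨ cong (∣ a ∩ S ∣ +_) (∣⊥∩p∣≡0 T) ⟩
      ∣ a ∩ S ∣ + 0           ≡⟨ +-identityʳ _ ⟩
      ∣ a ∩ S ∣               ∎)) (s a e₁)
      where open ≤-Reasoning
    on-parts _ b (inj₂ (refl , e₂)) =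
      subst (_∈ᴸ A) (sym (trans (∣[a++b]∩[S++T]∣ ∅ b) (cong (_+ ∣ b ∩ T ∣) (∣⊥∩p∣≡0 S)))) (t b e₂)

  ⊕-dominates : ∀ {S T} → U₁.Dominates full S → U₂.Dominates full T → U.Dominates full (S ++ T)
  ⊕-dominates {S} {T} dom₁ dom₂ x _ x∉S++T with ++-view {k} x
  ... | inj₁ (i , refl) with dom₁ i ∈⊤ (x∉S++T ∘ ↑ˡ∈++⁺ T)
  ...   | y , y∈S , (a , e , i∈a , y∈a , i≢y) =
    y ↑ˡ m , ↑ˡ∈++⁺ T y∈S ,
    a ++ ∅ , ⊕-edgeˡ e , ↑ˡ∈++⁺ ∅ i∈a , ↑ˡ∈++⁺ ∅ y∈a , i≢y ∘ ↑ˡ-injective m i y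
  ⊕-dominates {S} {T} dom₁ dom₂ x _ x∉S++T | inj₂ (j , refl) with dom₂ j ∈⊤ (x∉S++T ∘ ↑ʳ∈++⁺ S)
  ...   | y , y∈T , (b , e , j∈b , y∈b , j≢y) =
    k ↑ʳ y , ↑ʳ∈++⁺ S y∈T ,
    ∅ {k} ++ b , ⊕-edgeʳ e , ↑ʳ∈++⁺ ∅ j∈b , ↑ʳ∈++⁺ ∅ y∈b , j≢y ∘ ↑ʳ-injective k j y

  ⊕-numTransversals : ∀ A → numTransversals A 𝓗₁ * numTransversals A 𝓗₂ ≤ numTransversals A (𝓗₁ ⊕ 𝓗₂)
  ⊕-numTransversals A = countSubsets-++ k _ _ _ λ _ _ → ⊕-transversal

  ⊕-numMaximalTransversals : ∀ {A} → (∀ {m} → m ∈ᴸ A → m ≤ 1) → (0 ∈ᴸ A → 1 ∈ᴸ A) →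
    numMaximalTransversals A 𝓗₁ * numMaximalTransversals A 𝓗₂ ≤ numMaximalTransversals A (𝓗₁ ⊕ 𝓗₂)
  ⊕-numMaximalTransversals A≤1 0⇒1 = countSubsets-++ k _ _ _ λ _ _ s t →
    U.transversal∧dominates⇒maximal A≤1 (⊕-transversal (proj₁ s) (proj₁ t))
      (⊕-dominates (U₁.maximal-dominates 0⇒1 s) (U₂.maximal-dominates 0⇒1 t))

module _ (𝓗 : Hypergraph 2 n) where

  ∅-transversal0 : 1 ≤ numTransversals (0 ∷ []) 𝓗
  ∅-transversal0 = countSubsets-witness (isTransversal? _ 𝓗) ∅ λ H _ → here (∣p∩⊥∣≡0 H)

  full-transversal2 : 1 ≤ numTransversals (2 ∷ []) 𝓗
  full-transversal2 = countSubsets-witness (isTransversal? _ 𝓗) full λ H e →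
    here (trans (cong ∣_∣ (∩-identityʳ H)) (uniform 𝓗 H e))

  all-transversal012 : 2 ^ n ≤ numTransversals (0 ∷ 1 ∷ 2 ∷ []) 𝓗
  all-transversal012 = countSubsets-universal (isTransversal? _ 𝓗) λ S H e →
    ≤2⇒∈[0,1,2] (subst (∣ H ∩ S ∣ ≤_) (uniform 𝓗 H e) (∣p∩q∣≤∣p∣ H S))

complete2-noIsolated : NoIsolated (complete 2)
complete2-noIsolated v isolated = isolated (full , refl , ∈⊤)

path3-noIsolated : NoIsolated path3
path3-noIsolated zero             isolated = isolated (inside ∷ inside ∷ outside ∷ [] , refl , here)
path3-noIsolated (suc zero)       isolated = isolated (inside ∷ inside ∷ outside ∷ [] , refl , there here)
path3-noIsolated (suc (suc zero)) isolated = isolated (outside ∷ inside ∷ inside ∷ [] , refl , there (there here))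

-- Both graphs are named explicitly: comparing counts of convertible graphs would unfold the count.
≤-along : ∀ {c} (f : Hypergraph 2 n → ℕ) (𝓗 𝓗′ : Hypergraph 2 n) → 𝓗 ≡ 𝓗′ → c ≤ f 𝓗 → c ≤ f 𝓗′
≤-along f 𝓗 𝓗′ refl c≤f𝓗 = c≤f𝓗

complete2-maximal1 : numMaximalTransversals (1 ∷ []) (complete 2) ≡ 2
complete2-maximal1 = refl

complete3-maximal01 : numMaximalTransversals (0 ∷ 1 ∷ []) (complete 3) ≡ 3
complete3-maximal01 = refl

coveringMatching : ∀ n → Hypergraph 2 (2 + n)
coveringMatching 0 = complete 2
coveringMatching 1 = path3
coveringMatching (suc (suc n)) = complete 2 ⊕ coveringMatching n

coveringMatching-noIsolated : ∀ n → NoIsolated (coveringMatching n)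
coveringMatching-noIsolated 0 = complete2-noIsolated
coveringMatching-noIsolated 1 = path3-noIsolated
coveringMatching-noIsolated (suc (suc n)) =
  ⊕-noIsolated (complete 2) (coveringMatching n) complete2-noIsolated (coveringMatching-noIsolated n)

coveringMatching-transversals : ∀ A → 2 ≤ numTransversals A (complete 2) → 2 ≤ numTransversals A path3 →
                                ∀ n → 2 ^ ((2 + n) / 2) ≤ numTransversals A (coveringMatching n)
coveringMatching-transversals A edge path 0 = edge
coveringMatching-transversals A edge path 1 = path
coveringMatching-transversals A edge path (suc (suc n)) =
  ≤-along (numTransversals A) (complete 2 ⊕ coveringMatching n) (coveringMatching (suc (suc n))) refl (begin
  2 ^ ((4 + n) / 2)                  ≡⟨ cong (2 ^_) ([2+n]/2≡1+n/2 (2 + n)) ⟩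
  2 * 2 ^ ((2 + n) / 2)              ≤⟨ *-mono-≤ edge (coveringMatching-transversals A edge path n) ⟩
  numTransversals A (complete 2) * numTransversals A (coveringMatching n)
                                     ≤⟨ ⊕-numTransversals (complete 2) (coveringMatching n) A ⟩
  numTransversals A (complete 2 ⊕ coveringMatching n) ∎)
  where open ≤-Reasoning

matching : ∀ n → Hypergraph 2 n
matching 0 = edgeless 0
matching 1 = edgeless 1
matching (suc (suc n)) = complete 2 ⊕ matching n

matching-maximalTransversals1 : ∀ n → 2 ^ (n / 2) ≤ numMaximalTransversals (1 ∷ []) (matching n)
matching-maximalTransversals1 0 = edgeless-maximal (1 ∷ []) 0
matching-maximalTransversals1 1 = edgeless-maximal (1 ∷ []) 1
matching-maximalTransversals1 (suc (suc n)) =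
  ≤-along (numMaximalTransversals (1 ∷ [])) (complete 2 ⊕ matching n) (matching (suc (suc n))) refl (begin
  2 ^ ((2 + n) / 2)                  ≡⟨ cong (2 ^_) ([2+n]/2≡1+n/2 n) ⟩
  2 * 2 ^ (n / 2)                    ≤⟨ *-monoʳ-≤ 2 (matching-maximalTransversals1 n) ⟩
  2 * numMaximalTransversals (1 ∷ []) (matching n)
                                     ≡⟨ cong (_* numMaximalTransversals (1 ∷ []) (matching n)) complete2-maximal1 ⟨
  numMaximalTransversals (1 ∷ []) (complete 2) * numMaximalTransversals (1 ∷ []) (matching n)
                                     ≤⟨ ⊕-numMaximalTransversals (complete 2) (matching n) ≤1
                                          (λ { (here ()) ; (there ()) }) ⟩
  numMaximalTransversals (1 ∷ []) (complete 2 ⊕ matching n) ∎)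
  where
  open ≤-Reasoning
  ≤1 : ∀ {m} → m ∈ᴸ (1 ∷ []) → m ≤ 1
  ≤1 (here refl) = ≤-refl

moonMoserGraph : ∀ n → Hypergraph 2 n
moonMoserGraph 0 = edgeless 0
moonMoserGraph 1 = edgeless 1
moonMoserGraph 2 = complete 2
moonMoserGraph 3 = complete 3
moonMoserGraph 4 = complete 4
moonMoserGraph (suc (suc (suc (suc (suc n))))) = complete 3 ⊕ moonMoserGraph (suc (suc n))

moonMoserGraph-maximalTransversals01 : ∀ n →
                                       moonMoser n ≤ numMaximalTransversals (0 ∷ 1 ∷ []) (moonMoserGraph n)
moonMoserGraph-maximalTransversals01 0 = ≤-refl
moonMoserGraph-maximalTransversals01 1 = ≤-refl
moonMoserGraph-maximalTransversals01 2 = ≤-refl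
moonMoserGraph-maximalTransversals01 3 = ≤-refl
moonMoserGraph-maximalTransversals01 4 = ≤-refl
moonMoserGraph-maximalTransversals01 (suc (suc (suc (suc (suc n))))) =
  ≤-along (numMaximalTransversals (0 ∷ 1 ∷ [])) (complete 3 ⊕ moonMoserGraph (suc (suc n)))
          (moonMoserGraph (suc (suc (suc (suc (suc n)))))) refl (begin
  3 * moonMoser (suc (suc n))
    ≤⟨ *-monoʳ-≤ 3 (moonMoserGraph-maximalTransversals01 (suc (suc n))) ⟩
  3 * numMaximalTransversals (0 ∷ 1 ∷ []) (moonMoserGraph (suc (suc n)))
    ≡⟨ cong (_* numMaximalTransversals (0 ∷ 1 ∷ []) (moonMoserGraph (suc (suc n)))) complete3-maximal01 ⟨
  numMaximalTransversals (0 ∷ 1 ∷ []) (complete 3) *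
  numMaximalTransversals (0 ∷ 1 ∷ []) (moonMoserGraph (suc (suc n)))
    ≤⟨ ⊕-numMaximalTransversals (complete 3) (moonMoserGraph (suc (suc n))) ≤1 (λ _ → there (here refl)) ⟩
  numMaximalTransversals (0 ∷ 1 ∷ []) (complete 3 ⊕ moonMoserGraph (suc (suc n))) ∎)
  where
  open ≤-Reasoning
  ≤1 : ∀ {m} → m ∈ᴸ (0 ∷ 1 ∷ []) → m ≤ 1
  ≤1 (here refl)         = z≤n
  ≤1 (there (here refl)) = ≤-refl

isMaximum : ∀ {r} {P : Hypergraph r n → Set} {f : Hypergraph r n → ℕ} {c} →
            (∃ λ 𝓗 → P 𝓗 × c ≤ f 𝓗) → (∀ 𝓗 → P 𝓗 → f 𝓗 ≤ c) → IsMaximum P f c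
isMaximum (𝓗 , p , c≤f) ≤c = (𝓗 , p , ≤-antisym (≤c 𝓗 p) c≤f) , ≤c

g-values : ∀ n → 2 ≤ n →
    g-is 2 (0 ∷ []) n 1
  × g-is 2 (1 ∷ []) n (2 ^ (n / 2))
  × g-is 2 (2 ∷ []) n 1
  × g-is 2 (0 ∷ 1 ∷ []) n (1 + 2 ^ (n ∸ 1))
  × g-is 2 (1 ∷ 2 ∷ []) n (1 + 2 ^ (n ∸ 1))
  × g-is 2 (0 ∷ 2 ∷ []) n (2 ^ (n / 2))
  × g-is 2 (0 ∷ 1 ∷ 2 ∷ []) n (2 ^ n)
g-values (suc (suc k)) (s≤s (s≤s z≤n)) =
    isMaximum (𝓜 , 𝓜-noIso , ∅-transversal0 𝓜) TwoUniform.numTransversals0≤1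
  , isMaximum (𝓜 , 𝓜-noIso , coveringMatching-transversals (1 ∷ []) ≤-refl ≤-refl k)
              TwoUniform.numTransversals1≤2^[n/2]
  , isMaximum (𝓜 , 𝓜-noIso , full-transversal2 𝓜) TwoUniform.numTransversals2≤1
  , isMaximum (𝓢 , star-noIsolated k , star-transversals01 (suc k)) TwoUniform.numTransversals01≤independenceBound
  , isMaximum (𝓢 , star-noIsolated k , star-transversals12) TwoUniform.numTransversals12≤independenceBound
  , isMaximum (𝓜 , 𝓜-noIso , coveringMatching-transversals (0 ∷ 2 ∷ []) ≤-refl ≤-refl k)
              TwoUniform.numTransversals02≤2^[n/2]
  , isMaximum (𝓜 , 𝓜-noIso , all-transversal012 𝓜) (λ 𝓗 _ → countSubsets≤2^n (isTransversal? _ 𝓗))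
  where
  𝓜 = coveringMatching k
  𝓜-noIso = coveringMatching-noIsolated k
  𝓢 = star (suc k)
  star-transversals12 : 1 + 2 ^ suc k ≤ numTransversals (1 ∷ 2 ∷ []) 𝓢
  star-transversals12 = ≤-trans (star-transversals01 (suc k)) (TwoUniform.numTransversals-∁ 𝓢 λ where
    (here refl)         → there (here refl)
    (there (here refl)) → here refl)

h-values : ∀ n → 1 ≤ n →
    h-is 2 (0 ∷ []) n 1
  × h-is 2 (1 ∷ []) n (2 ^ (n / 2))
  × h-is 2 (2 ∷ []) n 1
  × h-is 2 (1 ∷ 2 ∷ []) n 1
  × h-is 2 (0 ∷ 2 ∷ []) n 1
  × h-is 2 (0 ∷ 1 ∷ 2 ∷ []) n 1
h-values n _ =
    unique unionClosed-0
  , isMaximum (matching n , _ , matching-maximalTransversals1 n)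
              (λ 𝓗 _ → TwoUniform.numMaximalTransversals1≤2^[n/2] 𝓗)
  , unique unionClosed-2 , unique unionClosed-12 , unique unionClosed-02 , unique unionClosed-012
  where
  unique : ∀ {A} → UnionClosed A → h-is 2 A n 1
  unique {A} closed = isMaximum (edgeless n , _ , edgeless-maximal A n)
                                (λ 𝓗 _ → TwoUniform.numMaximalTransversals≤1 𝓗 closed)

moonMoser-theorem : ∀ n → h-is 2 (0 ∷ 1 ∷ []) n (moonMoser n)
moonMoser-theorem n = isMaximum (moonMoserGraph n , _ , moonMoserGraph-maximalTransversals01 n)
                                (λ 𝓗 _ → TwoUniform.numMaximalTransversals01≤moonMoser 𝓗)

h01-values : ∀ n → 2 ≤ n →
    (n % 3 ≡ 0 → h-is 2 (0 ∷ 1 ∷ []) n (3 ^ (n / 3)))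
  × (n % 3 ≡ 1 → h-is 2 (0 ∷ 1 ∷ []) n (4 * 3 ^ (n / 3 ∸ 1)))
  × (n % 3 ≡ 2 → h-is 2 (0 ∷ 1 ∷ []) n (2 * 3 ^ (n / 3)))
h01-values n 2≤n =
    (λ r → value (trans (cong moonMoser (n≡ r)) (moonMoser-3t (n / 3))))
  , (λ r → value (residue1 (n / 3) (n≡ r)))
  , (λ r → value (trans (cong moonMoser (n≡ r)) (moonMoser-2+3t (n / 3))))
  where
  value : ∀ {c} → moonMoser n ≡ c → h-is 2 (0 ∷ 1 ∷ []) n c
  value eq = subst (h-is 2 (0 ∷ 1 ∷ []) n) eq (moonMoser-theorem n)
  n≡ : ∀ {r} → n % 3 ≡ r → n ≡ r + n / 3 * 3
  n≡ refl = m≡m%n+[m/n]*n n 3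
  residue1 : ∀ t → n ≡ 1 + t * 3 → moonMoser n ≡ 4 * 3 ^ (t ∸ 1)
  residue1 zero    refl = ⊥-elim (1+n≰n 2≤n)
  residue1 (suc t) refl = moonMoser-4+3t t

theorem3 : (∀ (n : ℕ) → 2 ≤ n →
    g-is 2 (0 ∷ []) n 1
    × g-is 2 (1 ∷ []) n (2 ^ (n / 2))
    × g-is 2 (2 ∷ []) n 1
    × g-is 2 (0 ∷ 1 ∷ []) n (1 + 2 ^ (n ∸ 1))
    × g-is 2 (1 ∷ 2 ∷ []) n (1 + 2 ^ (n ∸ 1))
    × g-is 2 (0 ∷ 2 ∷ []) n (2 ^ (n / 2))
    × g-is 2 (0 ∷ 1 ∷ 2 ∷ []) n (2 ^ n))
    × (∀ (n : ℕ) → 1 ≤ n →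
    h-is 2 (0 ∷ []) n 1
    × h-is 2 (1 ∷ []) n (2 ^ (n / 2))
    × h-is 2 (2 ∷ []) n 1
    × h-is 2 (1 ∷ 2 ∷ []) n 1
    × h-is 2 (0 ∷ 2 ∷ []) n 1
    × h-is 2 (0 ∷ 1 ∷ 2 ∷ []) n 1)
    × (∀ (n : ℕ) → 2 ≤ n →
    (n % 3 ≡ 0 → h-is 2 (0 ∷ 1 ∷ []) n (3 ^ (n / 3)))
    × (n % 3 ≡ 1 → h-is 2 (0 ∷ 1 ∷ []) n (4 * 3 ^ (n / 3 ∸ 1)))
    × (n % 3 ≡ 2 → h-is 2 (0 ∷ 1 ∷ []) n (2 * 3 ^ (n / 3))))
theorem3 = g-values , h-values , h01-values
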